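{- Let $P,Q$ be cut-free named $\mathrm{GS4}$ derivations with conclusions $\vdash\Gamma,A$ and $\vdash\Gamma,\bar A$ respectively, where all elements of $\Gamma$ are atomic formulas. Then the composite bl-graph $\langle\!\langle P\rangle\!\rangle\odot_{\mathrm{names}(A)}\langle\!\langle Q\rangle\!\rangle$ has at least one edge.
   Context: Named formulas and sequents. Fix a countably infinite set $\mathcal N$ of names and a set $\mathcal A$ of atoms with a fixpoint-free involution $\alpha\mapsto\bar\alpha$. Named formulas: $A,B::=\alpha^x\mid A\lor B\mid A\land B$ ($\alpha\in\mathcal A$, $x\in\mathcal N$); formulas $\alpha^x$ are atomic. Negation: $\overline{\alpha^x}=\bar\alpha^x$, $\overline{A\lor B}=\bar A\land\bar B$, $\overline{A\land B}=\bar A\lor\bar B$ (names preserved). $\mathrm{names}(A)$ is the set of names in $A$, $\mathrm{names}(\Gamma)=\bigcup_{A\in\Gamma}\mathrm{names}(A)$. $A\equiv B$ means $A,B$ coincide after erasing names. A formula is sharing-free if each name occurs in it at most once; a set is sharing-free if its members are sharing-free with pairwise disjoint name sets. A sequent $\vdash\Gamma$ is a finite sharing-free set $\Gamma$; in comma notation the components have pairwise disjoint name sets and $\Gamma,A=\Gamma\cup\{A\}$. Derivations. Named $\mathrm{GS4}$ derivations are finite trees of rule applications labelled with sharing-free sequents: axiom $\mathrm{ax}_{\{A,\bar B\}}$ (no premisses, conclusion $\vdash\Gamma,A,\bar B$, $A\equiv B$); cut (premisses $\vdash\Gamma,A$, $\vdash\Gamma,\bar A$, conclusion $\vdash\Gamma$);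 superposition $\sqcup$ (premisses $\vdash\Gamma$, $\vdash\Gamma$, conclusion $\vdash\Gamma$); $\lor$ (premiss $\vdash\Gamma,A,B$, conclusion $\vdash\Gamma,A\lor B$); $\land$ (premisses $\vdash\Gamma,A$, $\vdash\Gamma,B$, conclusion $\vdash\Gamma,A\land B$). Cut-free: no cut rule occurs. Branches. $\mathrm{Br}(\alpha^x)=\{\{x\}\}$, $\mathrm{Br}(B\lor C)=\{X\cup Y\mid X\in\mathrm{Br}(B),Y\in\mathrm{Br}(C)\}$, $\mathrm{Br}(B\land C)=\mathrm{Br}(B)\cup\mathrm{Br}(C)$; for sharing-free $\Gamma$, $\mathrm{Br}(\Gamma)=\{X\subseteq\mathrm{names}(\Gamma)\mid\forall A\in\Gamma,\ X\cap\mathrm{names}(A)\in\mathrm{Br}(A)\}$. Branch-labeled graphs. A bl-graph is $G=\langle V_G,\triangleleft_G\rangle$ with $V_G\subseteq\mathcal N$ and $\triangleleft_G$ a relation between 2-element subsets $e$ of $V_G$ and subsets $X\subseteq V_G$ such that $e\triangleleft_G X$ implies $e\subseteq X$; edges $E_G=\{e\mid\exists X.\,e\triangleleft_G X\}$. Union $\sqcup$ is componentwise union. For $I\subseteq\mathcal N$: $e\triangleleft^I_G X$ iff $e\triangleleft_G Y$ for some $Y$ with $X=Y\setminus I$. An alternating $X$-labeled path between bl-graphs $G,H$ through $I$ is a sequence $x_1,\dots,x_n$ ($n>1$) of pairwise distinct vertices of $G$ or $H$ with $x_i\in I$ for $1<i<n$ such that either $x_ix_{i+1}\triangleleft^I_G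 X$ for all odd $i$ and $x_ix_{i+1}\triangleleft^I_H X$ for all even $i$, or the same with $G,H$ swapped; it is complete if $x_1,x_n\notin I$. $G\odot_I H$ has vertex set $V=(V_G\cup V_H)\setminus I$ and, for $x\ne y\in V$, $X\subseteq V$, $xy\triangleleft X$ iff there is a complete alternating $X$-labeled path from $x$ to $y$ between $G$ and $H$ through $I$. $\mathrm{wk}_\Gamma(G)=\langle V_G\cup\mathrm{names}(\Gamma),\{(e,X\cup Y)\mid e\triangleleft_G X,\,Y\in\mathrm{Br}(\Gamma)\}\rangle$. $\mathrm{id}_{\{\alpha^x,\bar\alpha^y\}}=\langle\{x,y\},\{(xy,\{x,y\})\}\rangle$, and for disjoint sharing-free $A_1\lor A_2$, $\bar B_1\land\bar B_2$ with $A_i\equiv B_i$, $\mathrm{id}_{\{A_1\lor A_2,\bar B_1\land\bar B_2\}}=\mathrm{wk}_{\{A_2\}}(\mathrm{id}_{\{A_1,\bar B_1\}})\sqcup\mathrm{wk}_{\{A_1\}}(\mathrm{id}_{\{A_2,\bar B_2\}})$ (every axiom pair of non-atomic formulas is an unordered pair of this shape). $\langle\!\langle P\rangle\!\rangle$ is $\mathrm{wk}_\Gamma(\mathrm{id}_{\{A,\bar B\}})$ for an axiom $\mathrm{ax}_{\{A,\bar B\}}$ with conclusion $\vdash\Gamma,A,\bar B$; $\langle\!\langle Q\rangle\!\rangle\odot_{\mathrm{names}(A)}\langle\!\langle R\rangle\!\rangle$ for a cut with premiss derivations $Q$ of $\vdash\Gamma,A$, $R$ of $\vdash\Gamma,\bar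 A$; the union of the premisses' bl-graphs for $\sqcup,\lor,\land$. -}

module Defs where

open import Level using (0ℓ)
open import Data.Nat using (ℕ; _≡ᵇ_)
open import Data.Bool using (Bool; true; false; _∨_; _∧_; not)
open import Data.List using (List; []; _∷_; _++_)
open import Data.Bool.ListAction using (any)
open import Data.List.Membership.Propositional using (_∈_)
open import Data.List.Relation.Unary.All using (All)
open import Data.List.Relation.Unary.Unique.Propositional using (Unique)
open import Data.Product using (Σ; ∃; ∃-syntax; _×_; _,_)
open import Data.Sum using (_⊎_)
open import Data.Unit using (⊤)
open import Data.Empty using (⊥)
open import Relation.Nullary using (¬_)
open import Relation.Binary.PropositionalEquality using (_≡_; _≢_)
open import Function.Bundles using (_⇔_)

record AtomSys : Set₁ where
  field
    Atom     : Set
    bar      : Atom → Atom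
    bar-inv  : ∀ a → bar (bar a) ≡ a
    bar-fpf  : ∀ a → bar a ≢ a

Subset : Set
Subset = ℕ → Bool

_∈ˢ_ : ℕ → Subset → Set
z ∈ˢ X = X z ≡ true

_∉ˢ_ : ℕ → Subset → Set
z ∉ˢ X = X z ≡ false

_≐_ : Subset → Subset → Set
X ≐ Y = ∀ z → X z ≡ Y z

_⊆ˢ_ : Subset → Subset → Set
X ⊆ˢ Y = ∀ z → z ∈ˢ X → z ∈ˢ Y

_∪ˢ_ : Subset → Subset → Subset
(X ∪ˢ Y) z = X z ∨ Y z

_∩ˢ_ : Subset → Subset → Subset
(X ∩ˢ Y) z = X z ∧ Y z

_∖ˢ_ : Subset → Subset → Subset
(X ∖ˢ Y) z = X z ∧ not (Y z)

⟦_⟧₁ : ℕ → Subset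
⟦ x ⟧₁ z = z ≡ᵇ x

⟦_,_⟧₂ : ℕ → ℕ → Subset
⟦ x , y ⟧₂ z = (z ≡ᵇ x) ∨ (z ≡ᵇ y)

DisjointS : Subset → Subset → Set
DisjointS X Y = ∀ z → z ∈ˢ X → z ∈ˢ Y → ⊥

module GS4 (𝒜 : AtomSys) where
  open AtomSys 𝒜

  infixr 6 _⋁_
  infixr 7 _⋀_
  data Fm : Set where
    atom : Atom → ℕ → Fm
    _⋁_  : Fm → Fm → Fm
    _⋀_  : Fm → Fm → Fm

  neg : Fm → Fm
  neg (atom α x) = atom (bar α) x
  neg (A ⋁ B)    = neg A ⋀ neg B
  neg (A ⋀ B)    = neg A ⋁ neg B

  IsAtomic : Fm → Set
  IsAtomic A = ∃[ α ] ∃[ x ] A ≡ atom α x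

  data UFm : Set where
    uatom : Atom → UFm
    _u⋁_  : UFm → UFm → UFm
    _u⋀_  : UFm → UFm → UFm

  erase : Fm → UFm
  erase (atom α x) = uatom α
  erase (A ⋁ B)    = erase A u⋁ erase B
  erase (A ⋀ B)    = erase A u⋀ erase B

  _≡ₑ_ : Fm → Fm → Set
  A ≡ₑ B = erase A ≡ erase B

  names : Fm → Subset
  names (atom α x) = ⟦ x ⟧₁
  names (A ⋁ B)    = names A ∪ˢ names B
  names (A ⋀ B)    = names A ∪ˢ names B

  SharingFreeFm : Fm → Set
  SharingFreeFm (atom α x) = ⊤
  SharingFreeFm (A ⋁ B) = SharingFreeFm A × SharingFreeFm B × DisjointS (names A) (names B)
  SharingFreeFm (A ⋀ B) = SharingFreeFm A × SharingFreeFm B × DisjointS (names A) (names B)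

  -- Sequents: finite sets of formulas, represented by lists up to
  -- set equality (_≈_).
  Seq : Set
  Seq = List Fm

  _≈_ : Seq → Seq → Set
  Γ ≈ Δ = ∀ A → (A ∈ Γ) ⇔ (A ∈ Δ)

  namesL : Seq → Subset
  namesL Γ z = any (λ A → names A z) Γ

  SharingFree : Seq → Set
  SharingFree Γ = All SharingFreeFm Γ
                × (∀ A B → A ∈ Γ → B ∈ Γ → A ≢ B → DisjointS (names A) (names B))

  _is_,₁_ : Seq → Seq → Fm → Set
  Δ is Γ ,₁ A = (Δ ≈ (A ∷ Γ)) × DisjointS (namesL Γ) (names A)

  _is_,₂_,_ : Seq → Seq → Fm → Fm → Set
  Δ is Γ ,₂ A , B = (Δ ≈ (A ∷ B ∷ Γ)) × DisjointS (namesL Γ) (names A)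
                  × DisjointS (namesL Γ) (names B) × DisjointS (names A) (names B)

  data Deriv : Seq → Set where
    ax  : ∀ {Δ} (Γ : Seq) (A B : Fm) → A ≡ₑ B → SharingFree Δ
        → Δ is Γ ,₂ A , neg B → Deriv Δ
    cut : ∀ {Γ Δ₁ Δ₂} (A : Fm) → SharingFree Γ
        → Δ₁ is Γ ,₁ A → Δ₂ is Γ ,₁ neg A → Deriv Δ₁ → Deriv Δ₂ → Deriv Γ
    sup : ∀ {Γ Γ₁ Γ₂} → SharingFree Γ → Γ₁ ≈ Γ → Γ₂ ≈ Γ
        → Deriv Γ₁ → Deriv Γ₂ → Deriv Γ
    or  : ∀ {Δ Δ₁} (Γ : Seq) (A B : Fm) → SharingFree Δ
        → Δ₁ is Γ ,₂ A , B → Δ is Γ ,₁ (A ⋁ B) → Deriv Δ₁ → Deriv Δ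
    and : ∀ {Δ Δ₁ Δ₂} (Γ : Seq) (A B : Fm) → SharingFree Δ
        → Δ₁ is Γ ,₁ A → Δ₂ is Γ ,₁ B → Δ is Γ ,₁ (A ⋀ B)
        → Deriv Δ₁ → Deriv Δ₂ → Deriv Δ

  CutFree : ∀ {Δ} → Deriv Δ → Set
  CutFree (ax _ _ _ _ _ _)        = ⊤
  CutFree (cut _ _ _ _ _ _)       = ⊥
  CutFree (sup _ _ _ P Q)         = CutFree P × CutFree Q
  CutFree (or _ _ _ _ _ _ P)      = CutFree P
  CutFree (and _ _ _ _ _ _ _ P Q) = CutFree P × CutFree Q

  Br : Fm → Subset → Set
  Br (atom α x) X = X ≐ ⟦ x ⟧₁
  Br (B ⋁ C)    X = ∃[ Y ] ∃[ Z ] Br B Y × Br C Z × X ≐ (Y ∪ˢ Z)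
  Br (B ⋀ C)    X = Br B X ⊎ Br C X

  BrS : Seq → Subset → Set
  BrS Γ X = X ⊆ˢ namesL Γ × (∀ A → A ∈ Γ → Br A (X ∩ˢ names A))

  -- Branch-labeled graphs. Rel x y X means {x,y} ◁ X.
  record BLGraph : Set₁ where
    field
      V   : ℕ → Set
      Rel : ℕ → ℕ → Subset → Set
  open BLGraph public

  _∋_─_◁_ : BLGraph → ℕ → ℕ → Subset → Set
  G ∋ x ─ y ◁ X = x ≢ y × (Rel G x y X ⊎ Rel G y x X)

  HasEdge : BLGraph → Set
  HasEdge G = ∃[ x ] ∃[ y ] ∃[ X ] (G ∋ x ─ y ◁ X)

  _⊔_ : BLGraph → BLGraph → BLGraph
  G ⊔ H = record { V = λ z → V G z ⊎ V H z
                 ; Rel = λ x y X → Rel G x y X ⊎ Rel H x y X }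

  Lab : BLGraph → Subset → ℕ → ℕ → Subset → Set
  Lab G I x y X = ∃[ Y ] (G ∋ x ─ y ◁ Y) × X ≐ (Y ∖ˢ I)

  Alt : BLGraph → BLGraph → Subset → Subset → List ℕ → Set
  Alt G H I X (x ∷ y ∷ rest) = Lab G I x y X × Alt H G I X (y ∷ rest)
  Alt G H I X _              = ⊤

  CompletePath : BLGraph → BLGraph → Subset → Subset → ℕ → List ℕ → ℕ → Set
  CompletePath G H I X x ms y =
      Unique ps
    × All (λ z → V G z ⊎ V H z) ps
    × All (λ z → z ∈ˢ I) ms
    × x ∉ˢ I × y ∉ˢ I
    × (Alt G H I X ps ⊎ Alt H G I X ps)
    where ps = x ∷ ms ++ y ∷ []

  compose : BLGraph → Subset → BLGraph → BLGraph
  compose G I H = record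
    { V   = Vc
    ; Rel = λ x y X → x ≢ y × Vc x × Vc y × (∀ z → z ∈ˢ X → Vc z)
                    × ∃[ ms ] CompletePath G H I X x ms y }
    where
      Vc : ℕ → Set
      Vc z = (V G z ⊎ V H z) × z ∉ˢ I

  syntax compose G I H = G ⊙[ I ] H

  wk : Seq → BLGraph → BLGraph
  wk Γ G = record
    { V   = λ z → V G z ⊎ z ∈ˢ namesL Γ
    ; Rel = λ x y Z → ∃[ X ] ∃[ Y ] Rel G x y X × BrS Γ Y × Z ≐ (X ∪ˢ Y) }

  idG : Fm → Fm → BLGraph
  idG (atom α x) (atom β y) = record
    { V   = λ z → z ∈ˢ ⟦ x , y ⟧₂
    ; Rel = λ u v X → u ≡ x × v ≡ y × X ≐ ⟦ x , y ⟧₂ }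
  idG (C₁ ⋁ C₂) (D₁ ⋀ D₂) = wk (C₂ ∷ []) (idG C₁ D₁) ⊔ wk (C₁ ∷ []) (idG C₂ D₂)
  idG (C₁ ⋀ C₂) (D₁ ⋁ D₂) = wk (D₂ ∷ []) (idG D₁ C₁) ⊔ wk (D₁ ∷ []) (idG D₂ C₂)
  -- remaining shapes never arise from an axiom (A ≡ B forces one of the above)
  idG _ _ = record { V = λ _ → ⊥ ; Rel = λ _ _ _ → ⊥ }

  ⟪_⟫ : ∀ {Δ} → Deriv Δ → BLGraph
  ⟪ ax Γ A B _ _ _ ⟫          = wk Γ (idG A (neg B))
  ⟪ cut A _ _ _ Q R ⟫         = ⟪ Q ⟫ ⊙[ names A ] ⟪ R ⟫
  ⟪ sup _ _ _ P Q ⟫           = ⟪ P ⟫ ⊔ ⟪ Q ⟫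
  ⟪ or _ _ _ _ _ _ P ⟫        = ⟪ P ⟫
  ⟪ and _ _ _ _ _ _ _ P Q ⟫   = ⟪ P ⟫ ⊔ ⟪ Q ⟫

module Submission where

-- Every axiom of a cut-free derivation contributes links between complementary literal
-- occurrences; each link is an edge of the bl-graph labelled by a branch of the conclusion, and
-- every branch of the conclusion contains both ends of some link.  As Γ is atomic, removing the
-- cut names from such a label always leaves names Γ, so a complete alternating path of links of
-- P and Q through names A is an edge of the composite.  Such a path exists: otherwise take for S
-- the cut names reached from a free name by an alternating walk ending with a link of P, together
-- with the unreached names carrying the canonical literal of their complementary pair.  Some
-- branch of A avoids S or some branch of neg A lies in S, so some link of P has its cut ends
-- outside S or some link of Q has them inside S; either way two walks combine into a complete
-- path, the literal parity along walks excluding the degenerate cases.  This argument is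
-- classical, but complete paths are found by a finite search, which removes the double negation.

open import Defs
open import Data.List.Relation.Unary.All using (All; []; _∷_; all?)
open import Data.Bool using (Bool; true; false; not; _∨_; _∧_; if_then_else_; T)
open import Data.Bool.ListAction using (any)
open import Data.Bool.Properties using (not-involutive; ¬-not)
import Data.Bool.Properties as Bool
open import Data.Empty using (⊥; ⊥-elim)
open import Data.List using (List; []; _∷_; _++_; [_]; length; map)
open import Data.Maybe using (Maybe; just; nothing; fromMaybe)
open import Data.List.Properties using (length-++)
open import Data.List.Membership.Propositional using (_∈_; _∉_; lose)
open import Data.List.Membership.Propositional.Properties using (∈-++⁺ˡ; ∈-++⁺ʳ; ∈-++⁻; ∈-map⁺; ∈-∃++)
import Data.List.Membership.DecPropositional as DecMembership
open import Data.List.Relation.Unary.Any using (Any; here; there; any?; satisfied)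
import Data.List.Relation.Unary.All as All
import Data.List.Relation.Unary.All.Properties as AllP
import Data.List.Relation.Unary.AllPairs as AllPairs
open import Data.List.Relation.Unary.AllPairs using ([]; _∷_)
open import Data.List.Relation.Unary.Unique.Propositional using (Unique)
open import Data.List.Relation.Unary.Unique.DecPropositional using (unique?)
open import Data.Nat using (ℕ; zero; suc; _+_; _≡ᵇ_; _<_; _≤_; z≤n; s≤s; _≟_)
open import Data.Nat.Induction using (<-rec)
open import Data.Nat.Properties using (+-suc; <-cmp; ≡ᵇ⇒≡; ≡⇒≡ᵇ; module ≤-Reasoning)
open import Data.Product using (∃; ∃₂; _×_; _,_; proj₁; proj₂; -,_)
open import Data.Product.Properties using (≡-dec)
open import Data.Sum using (_⊎_; inj₁; inj₂)
import Data.Sum as Sum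
open import Data.Unit using (⊤; tt)
open import Function using (_∘_)
open import Relation.Binary using (tri<; tri≈; tri>)
open import Relation.Binary.PropositionalEquality using (_≡_; _≢_; refl; sym; trans; cong; cong₂; subst)
open import Function.Bundles using (Equivalence)
open import Function.Properties.Equivalence using () renaming (sym to ⇔-sym; refl to ⇔-refl)
open import Relation.Nullary using (¬_; Dec; yes; no)
open import Relation.Nullary.Decidable using (_×-dec_; _⊎-dec_; map′; decidable-stable; ¬¬-excluded-middle)

¬¬_ : Set → Set
¬¬ P = ¬ ¬ P

¬¬-least : (P : ℕ → Set) {k : ℕ} → P k → ¬¬ (∃ λ w → P w × (∀ {v} → v < w → ¬ P v))
¬¬-least P {k} = <-rec (λ k → P k → ¬¬ _) step k
  where
  step : ∀ k → (∀ {j} → j < k → P j → ¬¬ (∃ λ w → P w × (∀ {v} → v < w → ¬ P v)))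
       → P k → ¬¬ (∃ λ w → P w × (∀ {v} → v < w → ¬ P v))
  step k ih pk ¬least = ¬¬-excluded-middle {A = ∃ λ j → j < k × P j} λ
    { (yes (j , j<k , pj)) → ih j<k pj ¬least
    ; (no none)            → ¬least (k , pk , λ j<k pj → none (_ , j<k , pj)) }

module _ {A : Set} where

  unique⇒length≤ : ∀ {xs ys : List A} → Unique xs → All (_∈ ys) xs → length xs ≤ length ys
  unique⇒length≤ [] [] = z≤n
  unique⇒length≤ {x ∷ xs} (x∉xs ∷ u) (x∈ys ∷ xs⊆ys) with ys₁ , ys₂ , refl ← ∈-∃++ x∈ys = begin
    suc (length xs)               ≤⟨ s≤s (unique⇒length≤ u (All.zipWith (λ (x≢y , y∈) → drop x≢y y∈)
                                                                     (x∉xs , xs⊆ys))) ⟩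
    suc (length (ys₁ ++ ys₂))     ≡⟨ cong suc (length-++ ys₁) ⟩
    suc (length ys₁ + length ys₂) ≡⟨ sym (+-suc (length ys₁) (length ys₂)) ⟩
    length ys₁ + length (x ∷ ys₂) ≡⟨ sym (length-++ ys₁) ⟩
    length (ys₁ ++ x ∷ ys₂)       ∎
    where
    open ≤-Reasoning
    drop : ∀ {y} → x ≢ y → y ∈ ys₁ ++ x ∷ ys₂ → y ∈ ys₁ ++ ys₂
    drop x≢y y∈ with ∈-++⁻ ys₁ y∈
    ... | inj₁ y∈ys₁         = ∈-++⁺ˡ y∈ys₁
    ... | inj₂ (here refl)   = ⊥-elim (x≢y refl)
    ... | inj₂ (there y∈ys₂) = ∈-++⁺ʳ ys₁ y∈ys₂

  unique-++⁻ˡ : ∀ (xs : List A) {ys} → Unique (xs ++ ys) → Unique xs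
  unique-++⁻ˡ []       _         = []
  unique-++⁻ˡ (x ∷ xs) (x∉ ∷ u) = AllP.++⁻ˡ xs x∉ ∷ unique-++⁻ˡ xs u

  module ListSearch (alphabet : List A) where

    SomeList : ℕ → (List A → Set) → Set
    SomeList zero    P = P []
    SomeList (suc k) P = P [] ⊎ Any (λ a → SomeList k (P ∘ (a ∷_))) alphabet

    someList? : ∀ k {P} → (∀ xs → Dec (P xs)) → Dec (SomeList k P)
    someList? zero    P? = P? []
    someList? (suc k) P? = P? [] ⊎-dec any? (λ a → someList? k (P? ∘ (a ∷_))) alphabet

    someList-sound : ∀ k {P} → SomeList k P → ∃ P
    someList-sound zero    p        = [] , p
    someList-sound (suc k) (inj₁ p) = [] , p
    someList-sound (suc k) (inj₂ s) with a , s′ ← satisfied s with xs , p ← someList-sound k s′ = a ∷ xs , p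

    someList-complete : ∀ k {P} xs → All (_∈ alphabet) xs → length xs ≤ k → P xs → SomeList k P
    someList-complete zero    []       _          _         p = p
    someList-complete (suc k) []       _          _         p = inj₁ p
    someList-complete (suc k) (x ∷ xs) (x∈ ∷ xs∈) (s≤s len) p =
      inj₂ (lose x∈ (someList-complete k xs xs∈ len p))

module _ {X Y : Subset} {z : ℕ} where

  ∈-∪⁺ˡ : z ∈ˢ X → z ∈ˢ (X ∪ˢ Y)
  ∈-∪⁺ˡ p rewrite p = refl

  ∈-∪⁺ʳ : z ∈ˢ Y → z ∈ˢ (X ∪ˢ Y)
  ∈-∪⁺ʳ p rewrite p = Bool.∨-zeroʳ (X z)

  ∈-∪⁻ : z ∈ˢ (X ∪ˢ Y) → z ∈ˢ X ⊎ z ∈ˢ Y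
  ∈-∪⁻ p with X z
  ... | true  = inj₁ refl
  ... | false = inj₂ p

  ∈-∩⁺ : z ∈ˢ X → z ∈ˢ Y → z ∈ˢ (X ∩ˢ Y)
  ∈-∩⁺ p q rewrite p | q = refl

  ∈-∩⁻ : z ∈ˢ (X ∩ˢ Y) → z ∈ˢ X × z ∈ˢ Y
  ∈-∩⁻ p with X z | Y z
  ... | true | true = refl , refl

∈ˢ-or-∉ˢ : ∀ X z → z ∈ˢ X ⊎ z ∉ˢ X
∈ˢ-or-∉ˢ X z with X z
... | true  = inj₁ refl
... | false = inj₂ refl

∈ˢ⇒¬∉ˢ : ∀ {X z} → z ∈ˢ X → ¬ z ∉ˢ X
∈ˢ⇒¬∉ˢ p q with trans (sym p) q
... | ()

¬∈ˢ⇒∉ˢ : ∀ {X z} → ¬ z ∈ˢ X → z ∉ˢ X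
¬∈ˢ⇒∉ˢ {X} {z} ¬p with X z
... | true  = ⊥-elim (¬p refl)
... | false = refl

∈⟦⟧₁ : ∀ x → x ∈ˢ ⟦ x ⟧₁
∈⟦⟧₁ x with x ≡ᵇ x | ≡⇒≡ᵇ x x refl
... | true | _ = refl

∈⟦⟧₁⁻ : ∀ {x z} → z ∈ˢ ⟦ x ⟧₁ → z ≡ x
∈⟦⟧₁⁻ {x} {z} p = ≡ᵇ⇒≡ z x (subst T (sym p) tt)

≐-sym : ∀ {X Y} → X ≐ Y → Y ≐ X
≐-sym p z = sym (p z)

≐-trans : ∀ {X Y Z} → X ≐ Y → Y ≐ Z → X ≐ Z
≐-trans p q z = trans (p z) (q z)

∪-∩-disjointʳ : ∀ {X Y N} → DisjointS Y N → ((X ∪ˢ Y) ∩ˢ N) ≐ (X ∩ˢ N)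
∪-∩-disjointʳ {X} {Y} {N} d z with X z | Y z in y | N z in n
... | _     | true  | true  = ⊥-elim (d z y n)
... | true  | _     | true  = refl
... | false | false | true  = refl
... | x     | y′    | false = trans (Bool.∧-zeroʳ (x ∨ y′)) (sym (Bool.∧-zeroʳ x))

∪-∩-disjointˡ : ∀ {X Y N} → DisjointS X N → ((X ∪ˢ Y) ∩ˢ N) ≐ (Y ∩ˢ N)
∪-∩-disjointˡ {X} {Y} {N} d z =
  trans (cong (_∧ N z) (Bool.∨-comm (X z) (Y z))) (∪-∩-disjointʳ {Y} {X} {N} d z)

∩-∪-disjointʳ : ∀ {X M N} → DisjointS X N → (X ∩ˢ (M ∪ˢ N)) ≐ (X ∩ˢ M)
∩-∪-disjointʳ {X} {M} {N} d z with X z in x | M z | N z in n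
... | true  | true  | _     = refl
... | true  | false | true  = ⊥-elim (d z x n)
... | true  | false | false = refl
... | false | _     | _     = refl

∩-distribˡ-∪ : ∀ {X M N} → (X ∩ˢ (M ∪ˢ N)) ≐ ((X ∩ˢ M) ∪ˢ (X ∩ˢ N))
∩-distribˡ-∪ {X} {M} {N} z = Bool.∧-distribˡ-∨ (X z) (M z) (N z)

∪-comm : ∀ X Y → (X ∪ˢ Y) ≐ (Y ∪ˢ X)
∪-comm X Y z = Bool.∨-comm (X z) (Y z)

∪-assoc : ∀ X Y Z → ((X ∪ˢ Y) ∪ˢ Z) ≐ (X ∪ˢ (Y ∪ˢ Z))
∪-assoc X Y Z z = Bool.∨-assoc (X z) (Y z) (Z z)

∈-∖⁺ : ∀ {X Y z} → z ∈ˢ X → z ∉ˢ Y → z ∈ˢ (X ∖ˢ Y)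
∈-∖⁺ p q rewrite p | q = refl

∈-∖⁻ : ∀ {X Y z} → z ∈ˢ (X ∖ˢ Y) → z ∈ˢ X × z ∉ˢ Y
∈-∖⁻ {X} {Y} {z} p with X z | Y z
... | true | false = refl , refl

∩-⊆ˡ : ∀ {X Y} → (X ∩ˢ Y) ⊆ˢ X
∩-⊆ˡ {X} {Y} z p = proj₁ (∈-∩⁻ {X} {Y} p)

∪-rearrange : ∀ {X P Q} Y → X ≐ (P ∪ˢ Q) → (X ∪ˢ Y) ≐ ((P ∪ˢ Y) ∪ˢ Q)
∪-rearrange {X} {P} {Q} Y e z rewrite e z with P z
... | true  = refl
... | false = Bool.∨-comm (Q z) (Y z)

⊆-∪ˡ : ∀ {X Y} → X ⊆ˢ (X ∪ˢ Y)
⊆-∪ˡ {X} {Y} z = ∈-∪⁺ˡ {X} {Y}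

⊆-∪ʳ : ∀ {X Y} → Y ⊆ˢ (X ∪ˢ Y)
⊆-∪ʳ {X} {Y} z = ∈-∪⁺ʳ {X} {Y}

∪-least : ∀ {X Y Z} → X ⊆ˢ Z → Y ⊆ˢ Z → (X ∪ˢ Y) ⊆ˢ Z
∪-least {X} {Y} f g z p = Sum.[ f z , g z ] (∈-∪⁻ {X} {Y} p)

∪-mono : ∀ {X X′ Y Y′} → X ⊆ˢ X′ → Y ⊆ˢ Y′ → (X ∪ˢ Y) ⊆ˢ (X′ ∪ˢ Y′)
∪-mono {X} {X′} {Y} {Y′} f g z p with ∈-∪⁻ {X} {Y} p
... | inj₁ q = ∈-∪⁺ˡ {X′} {Y′} (f z q)
... | inj₂ q = ∈-∪⁺ʳ {X′} {Y′} (g z q)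

≐⇒⊆ : ∀ {X Y} → X ≐ Y → X ⊆ˢ Y
≐⇒⊆ e z p = trans (sym (e z)) p

≐∪⇒⊆ˡ : ∀ {X P Q} → X ≐ (P ∪ˢ Q) → P ⊆ˢ X
≐∪⇒⊆ˡ {P = P} {Q} e z p = trans (e z) (∈-∪⁺ˡ {P} {Q} p)

≐∪⇒⊆ʳ : ∀ {X P Q} → X ≐ (P ∪ˢ Q) → Q ⊆ˢ X
≐∪⇒⊆ʳ {P = P} {Q} e z p = trans (e z) (∈-∪⁺ʳ {P} {Q} p)

⊆-trans : ∀ {X Y Z} → X ⊆ˢ Y → Y ⊆ˢ Z → X ⊆ˢ Z
⊆-trans f g z p = g z (f z p)

⊆-antisym : ∀ {X Y} → X ⊆ˢ Y → Y ⊆ˢ X → X ≐ Y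
⊆-antisym {X} {Y} X⊆Y Y⊆X z with X z in x | Y z in y
... | true  | true  = refl
... | true  | false = trans (sym (X⊆Y z x)) y
... | false | true  = trans (sym x) (Y⊆X z y)
... | false | false = refl

∩-narrow : ∀ {X M N} → N ⊆ˢ M → (X ∩ˢ M) ⊆ˢ N → (X ∩ˢ M) ≐ (X ∩ˢ N)
∩-narrow {X} {M} {N} N⊆M X∩M⊆N = ⊆-antisym
  (λ z p → ∈-∩⁺ {X} {N} (proj₁ (∈-∩⁻ {X} {M} p)) (X∩M⊆N z p))
  (λ z p → let x , n = ∈-∩⁻ {X} {N} p in ∈-∩⁺ {X} {M} x (N⊆M z n))

∩-piece : ∀ {X Y Z M N} → Y ⊆ˢ M → Z ⊆ˢ N → DisjointS M N
        → (X ∩ˢ (M ∪ˢ N)) ≐ (Y ∪ˢ Z) → (X ∩ˢ M) ≐ Y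
∩-piece {X} {Y} {Z} {M} {N} Y⊆M Z⊆N M#N e = ⊆-antisym to from
  where
  to : (X ∩ˢ M) ⊆ˢ Y
  to z p with x , m ← ∈-∩⁻ {X} {M} p
       with ∈-∪⁻ {Y} {Z} (trans (sym (e z)) (∈-∩⁺ {X} {M ∪ˢ N} x (∈-∪⁺ˡ {M} {N} m)))
  ... | inj₁ y = y
  ... | inj₂ q = ⊥-elim (M#N z m (Z⊆N z q))
  from : Y ⊆ˢ (X ∩ˢ M)
  from z y = ∈-∩⁺ {X} {M} (proj₁ (∈-∩⁻ {X} {M ∪ˢ N} (trans (e z) (∈-∪⁺ˡ {Y} {Z} y)))) (Y⊆M z y)

⊆⇒∩≐ˡ : ∀ {X N} → X ⊆ˢ N → (X ∩ˢ N) ≐ X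
⊆⇒∩≐ˡ {X} {N} sub z with X z in x
... | true  = sub z x
... | false = refl

⊆⇒∩≐ʳ : ∀ {X N} → N ⊆ˢ X → (X ∩ˢ N) ≐ N
⊆⇒∩≐ʳ {X} {N} sub z = trans (Bool.∧-comm (X z) (N z)) (⊆⇒∩≐ˡ {N} {X} sub z)

module Atoms (𝒜 : AtomSys) where
  open AtomSys 𝒜

  bar-injective : ∀ {a b} → bar a ≡ bar b → a ≡ b
  bar-injective {a} {b} p = trans (sym (bar-inv a)) (trans (cong bar p) (bar-inv b))

  bar-swap : ∀ {a b} → a ≡ bar b → b ≡ bar a
  bar-swap {a} {b} p = trans (sym (bar-inv b)) (cong bar (sym p))

  module Canonical (lit : ℕ → Atom) where

    -- Of each complementary pair of atoms, the one occurring first in lit.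
    Canonical : Atom → Set
    Canonical a = ∃ λ w → lit w ≡ a × (∀ {v} → v < w → ¬ (lit v ≡ a ⊎ lit v ≡ bar a))

    canonical-exclusive : ∀ {a} → Canonical a → Canonical (bar a) → ⊥
    canonical-exclusive {a} (w₁ , p₁ , min₁) (w₂ , p₂ , min₂) with <-cmp w₁ w₂
    ... | tri< w₁<w₂ _ _ = min₂ w₁<w₂ (inj₂ (trans p₁ (sym (bar-inv a))))
    ... | tri≈ _ refl _  = bar-fpf a (trans (sym p₂) p₁)
    ... | tri> _ _ w₂<w₁ = min₁ w₂<w₁ (inj₂ p₂)

    ¬¬canonical : ∀ u → ¬¬ (Canonical (lit u) ⊎ Canonical (bar (lit u)))
    ¬¬canonical u k = ¬¬-least (λ w → lit w ≡ lit u ⊎ lit w ≡ bar (lit u)) (inj₁ refl) λ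
      { (w , inj₁ p , min) → k (inj₁ (w , p , min))
      ; (w , inj₂ p , min) → k (inj₂ (w , p , λ v<w → min v<w ∘ Sum.swap ∘ Sum.map₂ (λ q → trans q (bar-inv _)))) }

-- G and H are the axiom links of the two premisses of a cut (sides true and false), I the cut names.
module AlternatingPaths (𝒜 : AtomSys) (I : Subset) (G H : List (ℕ × ℕ))
                        (lit : ℕ → AtomSys.Atom 𝒜) where
  open AtomSys 𝒜
  open Atoms 𝒜
  open DecMembership _≟_ using () renaming (_∈?_ to _∈ℕ?_)

  linksOf : Bool → List (ℕ × ℕ)
  linksOf true  = G
  linksOf false = H

  Link : Bool → ℕ → ℕ → Set
  Link c u v = (u , v) ∈ linksOf c ⊎ (v , u) ∈ linksOf c

  Link-sym : ∀ c {u v} → Link c u v → Link c v u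
  Link-sym c = Sum.swap

  Link? : ∀ c u v → Dec (Link c u v)
  Link? c u v = ((u , v) ∈? linksOf c) ⊎-dec ((v , u) ∈? linksOf c)
    where open DecMembership (≡-dec _≟_ _≟_)

  Alternating : Bool → List ℕ → Set
  Alternating c (u ∷ v ∷ ps) = Link c u v × Alternating (not c) (v ∷ ps)
  Alternating c _            = ⊤

  alternating? : ∀ c ps → Dec (Alternating c ps)
  alternating? c []           = yes tt
  alternating? c (u ∷ [])     = yes tt
  alternating? c (u ∷ v ∷ ps) = Link? c u v ×-dec alternating? (not c) (v ∷ ps)

  path : ℕ → List ℕ → ℕ → List ℕ
  path x ms y = x ∷ ms ++ [ y ]

  IsCompleteAltPath : Bool → ℕ → List ℕ → ℕ → Set
  IsCompleteAltPath c x ms y =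
    Unique (path x ms y) × All (_∈ˢ I) ms × x ∉ˢ I × y ∉ˢ I × Alternating c (path x ms y)

  CompleteAltPath : Set
  CompleteAltPath = ∃ λ c → ∃ λ x → ∃ λ ms → ∃ λ y → IsCompleteAltPath c x ms y

  isCompleteAltPath? : ∀ c x ms y → Dec (IsCompleteAltPath c x ms y)
  isCompleteAltPath? c x ms y =
    unique? _≟_ (path x ms y) ×-dec all? (λ u → I u Bool.≟ true) ms ×-dec
    I x Bool.≟ false ×-dec I y Bool.≟ false ×-dec alternating? c (path x ms y)

  vertices : List ℕ
  vertices = map proj₁ (G ++ H) ++ map proj₂ (G ++ H)

  linksOf⊆ : ∀ c {e} → e ∈ linksOf c → e ∈ G ++ H
  linksOf⊆ true  = ∈-++⁺ˡ
  linksOf⊆ false = ∈-++⁺ʳ G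

  link-vertex : ∀ c {u v} → Link c u v → u ∈ vertices
  link-vertex c (inj₁ m) = ∈-++⁺ˡ (∈-map⁺ proj₁ (linksOf⊆ c m))
  link-vertex c (inj₂ m) = ∈-++⁺ʳ _ (∈-map⁺ proj₂ (linksOf⊆ c m))

  module _ {Q : ℕ → Set} (link-end : ∀ c {u v} → Link c u v → Q u) where

    alternating-all : ∀ c u v ps → Alternating c (u ∷ v ∷ ps) → All Q (u ∷ v ∷ ps)
    alternating-all c u v []       (e , _) = link-end c e ∷ link-end c (Link-sym c e) ∷ []
    alternating-all c u v (w ∷ ps) (e , a) = link-end c e ∷ alternating-all (not c) v w ps a

    path-all : ∀ c x ms y → Alternating c (path x ms y) → All Q (path x ms y)
    path-all c x []       y = alternating-all c x y []
    path-all c x (m ∷ ms) y = alternating-all c x m (ms ++ [ y ])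

  open ListSearch vertices

  -- A complete path visits each vertex at most once, so its inner part is no longer than vertices.
  PathSearch : Bool → Set
  PathSearch c = Any (λ x → Any (λ y → SomeList (length vertices) (λ ms → IsCompleteAltPath c x ms y))
                                vertices) vertices

  completeAltPath? : Dec CompleteAltPath
  completeAltPath? = map′ Sum.[ found true , found false ] complete (search? true ⊎-dec search? false)
    where
    search? : ∀ c → Dec (PathSearch c)
    search? c = any? (λ x → any? (λ y → someList? (length vertices) (λ ms → isCompleteAltPath? c x ms y))
                                 vertices) vertices

    found : ∀ c → PathSearch c → CompleteAltPath
    found c s with x , s′ ← satisfied s with y , s″ ← satisfied s′
            with ms , p ← someList-sound (length vertices) s″ = c , x , ms , y , p

    complete : CompleteAltPath → PathSearch true ⊎ PathSearch false
    complete (c , x , ms , y , p@(distinct , _ , _ , _ , alt)) = onSide c (lose x∈ (lose y∈ inner))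
      where
      onSide : ∀ c → PathSearch c → PathSearch true ⊎ PathSearch false
      onSide true  = inj₁
      onSide false = inj₂
      vs∈ = path-all link-vertex c x ms y alt
      x∈ = All.head vs∈
      ms∈ = AllP.++⁻ˡ ms (All.tail vs∈)
      y∈ = All.head (AllP.++⁻ʳ ms (All.tail vs∈))
      inner = someList-complete (length vertices) ms ms∈
                (unique⇒length≤ (unique-++⁻ˡ ms (AllPairs.tail distinct)) ms∈) p

  -- The literal of a vertex as seen on side c: the right side sees the negated literal on cut names.
  litOn : Bool → ℕ → Atom
  litOn true  u = lit u
  litOn false u = if I u then bar (lit u) else lit u

  litOn-cut : ∀ c {u} → u ∈ˢ I → litOn (not c) u ≡ bar (litOn c u)
  litOn-cut true      p rewrite p = refl
  litOn-cut false {u} p rewrite p = sym (bar-inv (lit u))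

  litOn-free : ∀ c {u} → u ∉ˢ I → litOn c u ≡ lit u
  litOn-free true  _ = refl
  litOn-free false p rewrite p = refl

  cut-link-literals : ∀ c {u v} → u ∈ˢ I → v ∈ˢ I → litOn c u ≡ bar (litOn c v) → lit u ≡ bar (lit v)
  cut-link-literals true  _  _  eq = eq
  cut-link-literals false iu iv eq =
    bar-injective (trans (sym (litOn-cut true iu)) (trans eq (cong bar (litOn-cut true iv))))

  -- Alternating walks from n whose later vertices are cut names; c is the side of the last link.
  data Walk (n : ℕ) : ℕ → Bool → Set where
    start  : ∀ {c v} → Link c n v → v ∈ˢ I → Walk n v c
    extend : ∀ {c u v} → Walk n u c → Link (not c) u v → v ∈ˢ I → Walk n v (not c)

  -- Walks without repeated vertices; the index lists the visited vertices, latest first.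
  data Path (n : ℕ) : ℕ → Bool → List ℕ → Set where
    start  : ∀ {c v} → Link c n v → v ∈ˢ I → Path n v c (v ∷ n ∷ [])
    extend : ∀ {c u v vs} → Path n u c vs → Link (not c) u v → v ∈ˢ I → v ∉ vs
           → Path n v (not c) (v ∷ vs)

  walk-end-cut : ∀ {n v c} → Walk n v c → v ∈ˢ I
  walk-end-cut (start _ iv)    = iv
  walk-end-cut (extend _ _ iv) = iv

  extend′ : ∀ {n u v c d} → Walk n u c → Link d u v → d ≡ not c → v ∈ˢ I → Walk n v d
  extend′ w e refl iv = extend w e iv

  path-shape : ∀ {n v c vs} → Path n v c vs → ∃ λ ms → vs ≡ v ∷ ms ++ [ n ] × All (_∈ˢ I) (v ∷ ms)
  path-shape (start _ iv) = [] , refl , iv ∷ []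
  path-shape (extend p _ iv _) with ms , refl , ms-cut ← path-shape p = -, refl , iv ∷ ms-cut

  path-end-cut : ∀ {n v c vs} → Path n v c vs → v ∈ˢ I
  path-end-cut p with _ , _ , iv ∷ _ ← path-shape p = iv

  path-unique : ∀ {n v c vs} → n ∉ˢ I → Path n v c vs → Unique vs
  path-unique nn (start _ iv)       = ((λ { refl → ∈ˢ⇒¬∉ˢ {I} iv nn }) ∷ []) ∷ [] ∷ []
  path-unique nn (extend p _ _ v∉) = AllP.¬Any⇒All¬ _ v∉ ∷ path-unique nn p

  alternating-not² : ∀ {c} ps → Alternating c ps → Alternating (not (not c)) ps
  alternating-not² {c} ps = subst (λ b → Alternating b ps) (sym (not-involutive c))

  path-alternating : ∀ {n v c vs} → Path n v c vs → Alternating c vs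
  path-alternating (start {c} e _) = Link-sym c e , tt
  path-alternating (extend {c} p e _ _) with _ , refl , _ ← path-shape p =
    Link-sym (not c) e , alternating-not² _ (path-alternating p)

  truncate : ∀ {n v c vs w} → Path n v c vs → w ∈ vs → w ≡ n ⊎ ∃₂ λ c′ vs′ → Path n w c′ vs′
  truncate p@(start _ _)         (here refl)         = inj₂ (-, -, p)
  truncate (start _ _)           (there (here refl)) = inj₁ refl
  truncate p@(extend _ _ _ _)    (here refl)         = inj₂ (-, -, p)
  truncate (extend p _ _ _)      (there w∈)          = truncate p w∈

  FreeWalk : Set
  FreeWalk = ∃₂ λ n m → n ∉ˢ I × m ∉ˢ I ×
             ∃ λ c → Link c n m ⊎ ∃ λ u → Walk n u c × Link (not c) u m

  -- The second walk is traversed backwards.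
  join : ∀ {n′ n v c d} → n′ ∉ˢ I → n ∉ˢ I → Walk n′ v d → d ≡ not c → Walk n v c → FreeWalk
  join nn′ nn w d≡ (start {c} e _) =
    -, -, nn′ , nn , -, inj₂ (-, w , subst (λ b → Link b _ _) (sym (trans (cong not d≡) (not-involutive c)))
                                      (Link-sym c e))
  join nn′ nn w d≡ (extend {c} p e _) =
    join nn′ nn (extend′ w (Link-sym (not c) e) (sym (trans (cong not d≡) (not-involutive (not c))))
                  (walk-end-cut p)) refl p

  GLinkAvoiding : (ℕ → Set) → Set
  GLinkAvoiding S = ∃₂ λ u v → (u , v) ∈ G × (u ∈ˢ I → ¬ S u) × (v ∈ˢ I → ¬ S v)

  HLinkWithin : (ℕ → Set) → Set
  HLinkWithin S = ∃₂ λ u v → (u , v) ∈ H × (u ∈ˢ I → S u) × (v ∈ˢ I → S v)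

  module _ (complementary : ∀ c {u v} → Link c u v → ¬¬ (litOn c u ≡ bar (litOn c v))) where

    link-irreflexive : ∀ c {u} → ¬ Link c u u
    link-irreflexive c {u} e = complementary c e λ eq → bar-fpf (litOn c u) (sym eq)

    private
      across-cut : ∀ c {u v} → u ∈ˢ I → litOn (not c) u ≡ bar (litOn (not c) v) → litOn (not c) v ≡ litOn c u
      across-cut c iu eq = sym (bar-injective (trans (sym (litOn-cut c iu)) eq))

      from-free : ∀ c {n v} → n ∉ˢ I → litOn c n ≡ bar (litOn c v) → litOn c v ≡ bar (lit n)
      from-free c nn eq = bar-swap (trans (sym (litOn-free c nn)) eq)

    path-literal : ∀ {n v c vs} → n ∉ˢ I → Path n v c vs → ¬¬ (litOn c v ≡ bar (lit n))
    path-literal nn (start {c} e _)        k = complementary c e (k ∘ from-free c nn)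
    path-literal nn (extend {c} p e _ _) k = path-literal nn p λ t → complementary (not c) e λ eq →
      k (trans (across-cut c (path-end-cut p) eq) t)

    both-sides : ∀ c {v a} → v ∈ˢ I → litOn c v ≡ a → litOn (not c) v ≡ a → ⊥
    both-sides c {v} iv p q = bar-fpf (litOn c v) (trans (sym (litOn-cut c iv)) (trans q (sym p)))

    walk⇒path : ∀ {n v c} → n ∉ˢ I → Walk n v c → ¬¬ (∃ (Path n v c))
    walk⇒path nn (start e iv) k = k (-, start e iv)
    walk⇒path {n} nn (extend {c} {u} {v} w e iv) k = walk⇒path nn w λ (vs , p) → extend-path p (v ∈ℕ? vs)
      where
      extend-path : ∀ {vs} → Path n u c vs → Dec (v ∈ vs) → ⊥
      extend-path p (no v∉) = k (-, extend p e iv v∉)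
      extend-path p (yes v∈) with truncate p v∈
      ... | inj₁ refl = ∈ˢ⇒¬∉ˢ {I} iv nn
      ... | inj₂ (c′ , vs′ , p′) with c′ Bool.≟ not c
      ...   | yes refl = k (vs′ , p′)
      ...   | no c′≢ with refl ← trans (¬-not c′≢) (not-involutive c) =
              path-literal nn p′ λ t′ → path-literal nn p λ t → complementary (not c) e λ eq →
              both-sides c iv t′ (trans (across-cut c (path-end-cut p) eq) t)

    path⇒completeAltPath : ∀ {n u m c vs} → n ∉ˢ I → Path n u c vs → Link (not c) u m → m ∉ˢ I
                      → ¬¬ CompleteAltPath
    path⇒completeAltPath {n} {u} {m} {c} {vs} nn p e nm k with m ∈ℕ? vs
    ... | yes m∈ with truncate p m∈
    ...   | inj₁ refl = path-literal nn p λ t → complementary (not c) e λ eq →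
                          bar-fpf (lit n) (sym (trans (sym (litOn-free (not c) nm))
                                                      (trans (across-cut c (path-end-cut p) eq) t)))
    ...   | inj₂ (_ , _ , p′) = ∈ˢ⇒¬∉ˢ {I} (path-end-cut p′) nm
    path⇒completeAltPath {n} {u} {m} {c} nn p e nm k | no m∉ with ms , refl , ms-cut ← path-shape p =
      k (not c , m , u ∷ ms , n ,
         AllP.¬Any⇒All¬ _ m∉ ∷ path-unique nn p , ms-cut , nm , nn ,
         Link-sym (not c) e , alternating-not² _ (path-alternating p))

    freeWalk⇒completeAltPath : FreeWalk → ¬¬ CompleteAltPath
    freeWalk⇒completeAltPath (n , m , nn , nm , c , inj₁ e) k with n ≟ m
    ... | yes refl = link-irreflexive c e
    ... | no n≢m   = k (c , n , [] , m , ((n≢m ∷ []) ∷ [] ∷ []) , [] , nn , nm , e , tt)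
    freeWalk⇒completeAltPath (n , m , nn , nm , c , inj₂ (u , w , e)) k =
      walk⇒path nn w λ (_ , p) → path⇒completeAltPath nn p e nm k

    module Refutation (branching : ∀ S → ¬¬ (GLinkAvoiding S ⊎ HLinkWithin S)) (no-path : ¬ CompleteAltPath) where
      open Canonical lit

      no-freeWalk : ¬ FreeWalk
      no-freeWalk fw = freeWalk⇒completeAltPath fw no-path

      Reach : Bool → ℕ → Set
      Reach c v = ∃ λ n → n ∉ˢ I × Walk n v c

      reach-exclusive : ∀ {v} → Reach true v → Reach false v → ⊥
      reach-exclusive (n , nn , w) (n′ , nn′ , w′) = no-freeWalk (join nn′ nn w′ refl w)

      reach-extend : ∀ {c u v} → Reach c u → Link (not c) u v → v ∈ˢ I → Reach (not c) v
      reach-extend (n , nn , w) e iv = n , nn , extend w e iv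

      Chosen : ℕ → Set
      Chosen v = Reach true v ⊎ (¬ Reach true v × ¬ Reach false v × Canonical (lit v))

      unchosen-reach : ∀ {u v} → u ∈ˢ I → v ∈ˢ I → Link true u v → ¬ Chosen u → ¬ Chosen v
                     → Canonical (lit u) → ⊥
      unchosen-reach iu iv e ¬u ¬v can = ¬¬-excluded-middle λ
        { (yes ru)  → ¬v (inj₁ (reach-extend ru e iv))
        ; (no ¬ru) → ¬u (inj₂ ((λ r → ¬u (inj₁ r)) , ¬ru , can)) }

      ¬GLinkAvoiding : ¬ GLinkAvoiding Chosen
      ¬GLinkAvoiding (u , v , m , ¬u , ¬v) with ∈ˢ-or-∉ˢ I u | ∈ˢ-or-∉ˢ I v
      ... | inj₂ nu | inj₂ nv = no-freeWalk (u , v , nu , nv , true , inj₁ (inj₁ m))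
      ... | inj₂ nu | inj₁ iv = ¬v iv (inj₁ (u , nu , start (inj₁ m) iv))
      ... | inj₁ iu | inj₂ nv = ¬u iu (inj₁ (v , nv , start (inj₂ m) iu))
      ... | inj₁ iu | inj₁ iv = complementary true (inj₁ m) λ eq → ¬¬canonical u λ
        { (inj₁ can) → unchosen-reach iu iv (inj₁ m) (¬u iu) (¬v iv) can
        ; (inj₂ can) → unchosen-reach iv iu (inj₂ m) (¬v iv) (¬u iu) (subst Canonical (sym (bar-swap eq)) can) }

      chosen⇒¬reach-false : ∀ {v} → Chosen v → ¬ Reach false v
      chosen⇒¬reach-false (inj₁ rt)            rf = reach-exclusive rt rf
      chosen⇒¬reach-false (inj₂ (_ , ¬rf , _)) rf = ¬rf rf

      ¬HLinkWithin : ¬ HLinkWithin Chosen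
      ¬HLinkWithin (u , v , m , su , sv) with ∈ˢ-or-∉ˢ I u | ∈ˢ-or-∉ˢ I v
      ... | inj₂ nu | inj₂ nv = no-freeWalk (u , v , nu , nv , false , inj₁ (inj₁ m))
      ... | inj₂ nu | inj₁ iv = chosen⇒¬reach-false (sv iv) (u , nu , start (inj₁ m) iv)
      ... | inj₁ iu | inj₂ nv = chosen⇒¬reach-false (su iu) (v , nv , start (inj₂ m) iu)
      ... | inj₁ iu | inj₁ iv = both-chosen (su iu) (sv iv)
        where
        both-chosen : Chosen u → Chosen v → ⊥
        both-chosen (inj₁ ru) (inj₁ rv)            = reach-exclusive rv (reach-extend ru (inj₁ m) iv)
        both-chosen (inj₁ ru) (inj₂ (_ , ¬rv , _)) = ¬rv (reach-extend ru (inj₁ m) iv)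
        both-chosen (inj₂ (_ , ¬ru , _)) (inj₁ rv) = ¬ru (reach-extend rv (inj₂ m) iu)
        both-chosen (inj₂ (_ , _ , cu)) (inj₂ (_ , _ , cv)) = complementary false (inj₁ m) λ eq →
          canonical-exclusive cv (subst Canonical (cut-link-literals false iu iv eq) cu)

    completeAltPath : (∀ S → ¬¬ (GLinkAvoiding S ⊎ HLinkWithin S)) → CompleteAltPath
    completeAltPath branching = decidable-stable completeAltPath? λ no-path →
      let open Refutation branching no-path in branching Chosen Sum.[ ¬GLinkAvoiding , ¬HLinkWithin ]

module Sequents (𝒜 : AtomSys) where
  open GS4 𝒜

  ∈,₁⁻ : ∀ {Δ Γ A C} → Δ is Γ ,₁ A → C ∈ Δ → C ≡ A ⊎ C ∈ Γ
  ∈,₁⁻ (eq , _) m with Equivalence.to (eq _) m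
  ... | here p  = inj₁ p
  ... | there q = inj₂ q

  head∈,₁ : ∀ {Δ Γ A} → Δ is Γ ,₁ A → A ∈ Δ
  head∈,₁ (eq , _) = Equivalence.from (eq _) (here refl)

  ∈,₁⁺ : ∀ {Δ Γ A C} → Δ is Γ ,₁ A → C ∈ Γ → C ∈ Δ
  ∈,₁⁺ (eq , _) m = Equivalence.from (eq _) (there m)

  ∈,₂⁻ : ∀ {Δ Γ A B C} → Δ is Γ ,₂ A , B → C ∈ Δ → C ≡ A ⊎ C ≡ B ⊎ C ∈ Γ
  ∈,₂⁻ (eq , _) m with Equivalence.to (eq _) m
  ... | here p          = inj₁ p
  ... | there (here p)  = inj₂ (inj₁ p)
  ... | there (there q) = inj₂ (inj₂ q)

  fst∈,₂ : ∀ {Δ Γ A B} → Δ is Γ ,₂ A , B → A ∈ Δ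
  fst∈,₂ (eq , _) = Equivalence.from (eq _) (here refl)

  snd∈,₂ : ∀ {Δ Γ A B} → Δ is Γ ,₂ A , B → B ∈ Δ
  snd∈,₂ (eq , _) = Equivalence.from (eq _) (there (here refl))

  ∈,₂⁺ : ∀ {Δ Γ A B C} → Δ is Γ ,₂ A , B → C ∈ Γ → C ∈ Δ
  ∈,₂⁺ (eq , _) m = Equivalence.from (eq _) (there (there m))

  ≈⇒⊆ : ∀ {Γ Δ C} → Γ ≈ Δ → C ∈ Γ → C ∈ Δ
  ≈⇒⊆ eq = Equivalence.to (eq _)

  ≈-sym : ∀ {Γ Δ} → Γ ≈ Δ → Δ ≈ Γ
  ≈-sym eq C = ⇔-sym (eq C)

  ∈namesL⁺ : ∀ {Γ C z} → C ∈ Γ → z ∈ˢ names C → z ∈ˢ namesL Γ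
  ∈namesL⁺ {C ∷ Γ}      (here refl) p = ∈-∪⁺ˡ {names C} {namesL Γ} p
  ∈namesL⁺ {C′ ∷ Γ} {C} (there m)   p = ∈-∪⁺ʳ {names C′} {namesL Γ} (∈namesL⁺ m p)

  ∈namesL⁻ : ∀ {Γ z} → z ∈ˢ namesL Γ → ∃ λ C → C ∈ Γ × z ∈ˢ names C
  ∈namesL⁻ {C ∷ Γ} p with ∈-∪⁻ {names C} {namesL Γ} p
  ... | inj₁ q = C , here refl , q
  ... | inj₂ q with C′ , m , r ← ∈namesL⁻ {Γ} q = C′ , there m , r

  namesL-mono : ∀ {Γ Δ} → (∀ {C} → C ∈ Γ → C ∈ Δ) → namesL Γ ⊆ˢ namesL Δ
  namesL-mono {Γ} f z p with C , m , q ← ∈namesL⁻ {Γ} p = ∈namesL⁺ (f m) q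

  namesL-,₁⁻ : ∀ {Δ Γ A z} → Δ is Γ ,₁ A → z ∈ˢ namesL Δ → z ∈ˢ names A ⊎ z ∈ˢ namesL Γ
  namesL-,₁⁻ {Δ} i p with C , m , q ← ∈namesL⁻ {Δ} p with ∈,₁⁻ i m
  ... | inj₁ refl = inj₁ q
  ... | inj₂ mΓ  = inj₂ (∈namesL⁺ mΓ q)

  namesL-,₁⁺ : ∀ {Δ Γ A z} → Δ is Γ ,₁ A → z ∈ˢ names A ⊎ z ∈ˢ namesL Γ → z ∈ˢ namesL Δ
  namesL-,₁⁺ i (inj₁ p) = ∈namesL⁺ (head∈,₁ i) p
  namesL-,₁⁺ i (inj₂ p) = namesL-mono (∈,₁⁺ i) _ p

  namesL-,₂⁻ : ∀ {Δ Γ A B z} → Δ is Γ ,₂ A , B → z ∈ˢ namesL Δ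
             → z ∈ˢ names A ⊎ z ∈ˢ names B ⊎ z ∈ˢ namesL Γ
  namesL-,₂⁻ {Δ} i p with C , m , q ← ∈namesL⁻ {Δ} p with ∈,₂⁻ i m
  ... | inj₁ refl         = inj₁ q
  ... | inj₂ (inj₁ refl) = inj₂ (inj₁ q)
  ... | inj₂ (inj₂ mΓ)   = inj₂ (inj₂ (∈namesL⁺ mΓ q))

  namesL-,₂⁺ : ∀ {Δ Γ A B z} → Δ is Γ ,₂ A , B → z ∈ˢ names A ⊎ z ∈ˢ names B ⊎ z ∈ˢ namesL Γ
             → z ∈ˢ namesL Δ
  namesL-,₂⁺ i (inj₁ p)        = ∈namesL⁺ (fst∈,₂ i) p
  namesL-,₂⁺ i (inj₂ (inj₁ p)) = ∈namesL⁺ (snd∈,₂ i) p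
  namesL-,₂⁺ i (inj₂ (inj₂ p)) = namesL-mono (∈,₂⁺ i) _ p

  names-neg : ∀ C → names (neg C) ≐ names C
  names-neg (atom α x) z = refl
  names-neg (A ⋁ B)    z = cong₂ _∨_ (names-neg A z) (names-neg B z)
  names-neg (A ⋀ B)    z = cong₂ _∨_ (names-neg A z) (names-neg B z)

  conclusion-sharingFree : ∀ {Δ} → Deriv Δ → SharingFree Δ
  conclusion-sharingFree (ax _ _ _ _ sf _)        = sf
  conclusion-sharingFree (cut _ sf _ _ _ _)       = sf
  conclusion-sharingFree (sup sf _ _ _ _)         = sf
  conclusion-sharingFree (or _ _ _ sf _ _ _)      = sf
  conclusion-sharingFree (and _ _ _ sf _ _ _ _ _) = sf

  sharingFree-∈ : ∀ {Δ C} → SharingFree Δ → C ∈ Δ → SharingFreeFm C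
  sharingFree-∈ sf = All.lookup (proj₁ sf)

  Separated : Seq → Set
  Separated Γ = ∀ A B → A ∈ Γ → B ∈ Γ → A ≢ B → DisjointS (names A) (names B)

  separated-mono : ∀ {Γ Δ} → (∀ {C} → C ∈ Γ → C ∈ Δ) → Separated Δ → Separated Γ
  separated-mono f s A B mA mB = s A B (f mA) (f mB)

module Branches (𝒜 : AtomSys) where
  open GS4 𝒜
  open Sequents 𝒜

  Br-resp-≐ : ∀ C {X Y} → Br C X → X ≐ Y → Br C Y
  Br-resp-≐ (atom α x) b       e = ≐-trans (≐-sym e) b
  Br-resp-≐ (B ⋁ C) (Y , Z , bY , bZ , e′) e = Y , Z , bY , bZ , ≐-trans (≐-sym e) e′
  Br-resp-≐ (B ⋀ C) (inj₁ b) e = inj₁ (Br-resp-≐ B b e)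
  Br-resp-≐ (B ⋀ C) (inj₂ b) e = inj₂ (Br-resp-≐ C b e)

  Br⇒⊆names : ∀ C {X} → Br C X → X ⊆ˢ names C
  Br⇒⊆names (atom α x) b z p = trans (sym (b z)) p
  Br⇒⊆names (B ⋁ C) (Y , Z , bY , bZ , e) z p with ∈-∪⁻ {Y} {Z} (trans (sym (e z)) p)
  ... | inj₁ q = ∈-∪⁺ˡ {names B} {names C} (Br⇒⊆names B bY z q)
  ... | inj₂ q = ∈-∪⁺ʳ {names B} {names C} (Br⇒⊆names C bZ z q)
  Br⇒⊆names (B ⋀ C) (inj₁ b) z p = ∈-∪⁺ˡ {names B} {names C} (Br⇒⊆names B b z p)
  Br⇒⊆names (B ⋀ C) (inj₂ b) z p = ∈-∪⁺ʳ {names B} {names C} (Br⇒⊆names C b z p)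

  leftBranch : Fm → Subset
  leftBranch (atom α x) = ⟦ x ⟧₁
  leftBranch (A ⋁ B)    = leftBranch A ∪ˢ leftBranch B
  leftBranch (A ⋀ B)    = leftBranch A

  Br-leftBranch : ∀ C → Br C (leftBranch C)
  Br-leftBranch (atom α x) z = refl
  Br-leftBranch (A ⋁ B)      = -, -, Br-leftBranch A , Br-leftBranch B , λ z → refl
  Br-leftBranch (A ⋀ B)      = inj₁ (Br-leftBranch A)

  leftBranchS : Seq → Subset
  leftBranchS Γ z = any (λ C → leftBranch C z) Γ

  BrS-leftBranchS : ∀ Γ → Separated Γ → BrS Γ (leftBranchS Γ)
  BrS-leftBranchS Γ sep = ⊆namesL , restrict
    where
    ∈leftBranchS⁻ : ∀ {Γ z} → z ∈ˢ leftBranchS Γ → ∃ λ C → C ∈ Γ × z ∈ˢ leftBranch C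
    ∈leftBranchS⁻ {C ∷ Γ} p with ∈-∪⁻ {leftBranch C} {leftBranchS Γ} p
    ... | inj₁ q = C , here refl , q
    ... | inj₂ q with C′ , m , r ← ∈leftBranchS⁻ {Γ} q = C′ , there m , r

    ∈leftBranchS⁺ : ∀ {Γ C z} → C ∈ Γ → z ∈ˢ leftBranch C → z ∈ˢ leftBranchS Γ
    ∈leftBranchS⁺ {C ∷ Γ}       (here refl) p = ∈-∪⁺ˡ {leftBranch C} {leftBranchS Γ} p
    ∈leftBranchS⁺ {C′ ∷ Γ} {C} (there m)   p =
      ∈-∪⁺ʳ {leftBranch C′} {leftBranchS Γ} (∈leftBranchS⁺ m p)

    ⊆namesL : leftBranchS Γ ⊆ˢ namesL Γ
    ⊆namesL z p with C , m , q ← ∈leftBranchS⁻ {Γ} p = ∈namesL⁺ m (Br⇒⊆names C (Br-leftBranch C) z q)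

    restriction : ∀ {C} → C ∈ Γ → (leftBranchS Γ ∩ˢ names C) ≐ leftBranch C
    restriction {C} m z with leftBranch C z in eC
    ... | true  = ∈-∩⁺ {leftBranchS Γ} {names C} (∈leftBranchS⁺ m eC) (Br⇒⊆names C (Br-leftBranch C) z eC)
    ... | false = ¬∈ˢ⇒∉ˢ {leftBranchS Γ ∩ˢ names C} outside
      where
      outside : z ∈ˢ (leftBranchS Γ ∩ˢ names C) → ⊥
      outside p with inΓ , inC ← ∈-∩⁻ {leftBranchS Γ} {names C} p
                      with C′ , m′ , q ← ∈leftBranchS⁻ {Γ} inΓ =
        ¬¬-excluded-middle {A = C′ ≡ C} λ
          { (yes refl) → ∈ˢ⇒¬∉ˢ {leftBranch C} q eC
          ; (no C′≢C)  → sep C′ C m′ m C′≢C z (Br⇒⊆names C′ (Br-leftBranch C′) z q) inC }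

    restrict : ∀ C → C ∈ Γ → Br C (leftBranchS Γ ∩ˢ names C)
    restrict C m = Br-resp-≐ C (Br-leftBranch C) (≐-sym (restriction m))

  BrS-resp-≈ : ∀ {Γ Δ X} → Γ ≈ Δ → BrS Γ X → BrS Δ X
  BrS-resp-≈ eq (sub , restrict) = (λ z p → namesL-mono (≈⇒⊆ eq) z (sub z p)) ,
                                   λ C m → restrict C (≈⇒⊆ (≈-sym eq) m)

  BrS-resp-≐ : ∀ {Γ X Y} → BrS Γ X → X ≐ Y → BrS Γ Y
  BrS-resp-≐ {X = X} (sub , restrict) e =
    (λ z p → sub z (trans (e z) p)) , λ C m → Br-resp-≐ C (restrict C m) (λ z → cong (_∧ names C z) (e z))

  BrS-[_] : ∀ C {Y} → Br C Y → BrS [ C ] Y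
  BrS-[ C ] {Y} b = (λ z p → ∈namesL⁺ {[ C ]} (here refl) (Br⇒⊆names C b z p)) ,
                    λ { _ (here refl) → Br-resp-≐ C b (≐-sym (⊆⇒∩≐ˡ (Br⇒⊆names C b))) }

  BrS-,₁ : ∀ {Δ Γ A P R} → Δ is Γ ,₁ A → Br A P → BrS Γ R → BrS Δ (P ∪ˢ R)
  BrS-,₁ {Δ} {Γ} {A} {P} {R} i@(_ , Γ#A) bP (R⊆ , bR) = sub , restrict
    where
    P⊆ = Br⇒⊆names A bP
    sub : (P ∪ˢ R) ⊆ˢ namesL Δ
    sub z p with ∈-∪⁻ {P} {R} p
    ... | inj₁ q = ∈namesL⁺ (head∈,₁ i) (P⊆ z q)
    ... | inj₂ q = namesL-mono (∈,₁⁺ i) z (R⊆ z q)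
    restrict : ∀ C → C ∈ Δ → Br C ((P ∪ˢ R) ∩ˢ names C)
    restrict C m with ∈,₁⁻ i m
    ... | inj₁ refl = Br-resp-≐ A bP (≐-sym (≐-trans (∪-∩-disjointʳ {P} λ z r a → Γ#A z (R⊆ z r) a)
                                                      (⊆⇒∩≐ˡ P⊆)))
    ... | inj₂ mΓ  = Br-resp-≐ C (bR C mΓ)
                       (≐-sym (∪-∩-disjointˡ {P} λ z p c → Γ#A z (∈namesL⁺ mΓ c) (P⊆ z p)))

  BrS-,₂ : ∀ {Δ Γ A B P Q R} → Δ is Γ ,₂ A , B → Br A P → Br B Q → BrS Γ R
         → BrS Δ (P ∪ˢ (Q ∪ˢ R))
  BrS-,₂ {Γ = Γ} {A} {B} (eq , Γ#A , Γ#B , A#B) bP bQ bR =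
    BrS-,₁ (eq , B∷Γ#A) bP (BrS-,₁ ((λ _ → ⇔-refl) , Γ#B) bQ bR)
    where
    B∷Γ#A : DisjointS (namesL (B ∷ Γ)) (names A)
    B∷Γ#A z p a with ∈-∪⁻ {names B} {namesL Γ} p
    ... | inj₁ b = A#B z a b
    ... | inj₂ g = Γ#A z g a

  BrS-atomic : ∀ {Γ} → All IsAtomic Γ → BrS Γ (namesL Γ)
  BrS-atomic {Γ} at = (λ z p → p) , restrict
    where
    restrict : ∀ C → C ∈ Γ → Br C (namesL Γ ∩ˢ names C)
    restrict C m with α , n , refl ← All.lookup at m = ⊆⇒∩≐ʳ (λ z p → ∈namesL⁺ m p)

  BrS-⋁⁺ : ∀ {Δ₁ Δ Γ A B L} → Δ₁ is Γ ,₂ A , B → Δ is Γ ,₁ (A ⋁ B) → BrS Δ₁ L → BrS Δ L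
  BrS-⋁⁺ {Δ₁} {Δ} {Γ} {A} {B} {L} i₁ i (sub , restrict) = sub′ , restrict′
    where
    sub′ : L ⊆ˢ namesL Δ
    sub′ z p with namesL-,₂⁻ i₁ (sub z p)
    ... | inj₁ a         = namesL-,₁⁺ i (inj₁ (∈-∪⁺ˡ {names A} {names B} a))
    ... | inj₂ (inj₁ b) = namesL-,₁⁺ i (inj₁ (∈-∪⁺ʳ {names A} {names B} b))
    ... | inj₂ (inj₂ g) = namesL-,₁⁺ i (inj₂ g)
    restrict′ : ∀ C → C ∈ Δ → Br C (L ∩ˢ names C)
    restrict′ C m with ∈,₁⁻ i m
    ... | inj₁ refl = -, -, restrict A (fst∈,₂ i₁) , restrict B (snd∈,₂ i₁) , ∩-distribˡ-∪ {L}
    ... | inj₂ mΓ  = restrict C (∈,₂⁺ i₁ mΓ)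

  BrS-⋁⁻ : ∀ {Δ₁ Δ Γ A B X} → Δ₁ is Γ ,₂ A , B → Δ is Γ ,₁ (A ⋁ B)
         → DisjointS (names A) (names B) → BrS Δ X → BrS Δ₁ X
  BrS-⋁⁻ {Δ₁} {Δ} {Γ} {A} {B} {X} i₁ i A#B (sub , restrict)
    with Y , Z , bY , bZ , e ← restrict _ (head∈,₁ i) = sub′ , restrict′
    where
    sub′ : X ⊆ˢ namesL Δ₁
    sub′ z p with namesL-,₁⁻ i (sub z p)
    ... | inj₁ ab = namesL-,₂⁺ i₁ (Sum.map₂ inj₁ (∈-∪⁻ {names A} {names B} ab))
    ... | inj₂ g  = namesL-,₂⁺ i₁ (inj₂ (inj₂ g))
    e′ : (X ∩ˢ (names B ∪ˢ names A)) ≐ (Z ∪ˢ Y)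
    e′ z = trans (cong (X z ∧_) (∪-comm (names B) (names A) z)) (trans (e z) (∪-comm Y Z z))
    restrict′ : ∀ C → C ∈ Δ₁ → Br C (X ∩ˢ names C)
    restrict′ C m with ∈,₂⁻ i₁ m
    ... | inj₁ refl        = Br-resp-≐ A bY (≐-sym (∩-piece (Br⇒⊆names A bY) (Br⇒⊆names B bZ) A#B e))
    ... | inj₂ (inj₁ refl) = Br-resp-≐ B bZ (≐-sym (∩-piece (Br⇒⊆names B bZ) (Br⇒⊆names A bY)
                                                              (λ z b a → A#B z a b) e′))
    ... | inj₂ (inj₂ mΓ)  = restrict C (∈,₁⁺ i mΓ)

  BrS-replace⁺ : ∀ {Δ₁ Δ Γ A D L} → Δ₁ is Γ ,₁ A → Δ is Γ ,₁ D → names A ⊆ˢ names D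
               → (∀ {X} → Br A X → Br D X) → BrS Δ₁ L → BrS Δ L
  BrS-replace⁺ {Δ₁} {Δ} {Γ} {A} {D} {L} i₁ i@(_ , Γ#D) A⊆D lift (sub , restrict) = sub′ , restrict′
    where
    sub′ : L ⊆ˢ namesL Δ
    sub′ z p = namesL-,₁⁺ i (Sum.map₁ (A⊆D z) (namesL-,₁⁻ i₁ (sub z p)))
    within : (L ∩ˢ names D) ⊆ˢ names A
    within z p with l , d ← ∈-∩⁻ {L} {names D} p with namesL-,₁⁻ i₁ (sub z l)
    ... | inj₁ a = a
    ... | inj₂ g = ⊥-elim (Γ#D z g d)
    restrict′ : ∀ C → C ∈ Δ → Br C (L ∩ˢ names C)
    restrict′ C m with ∈,₁⁻ i m
    ... | inj₁ refl = Br-resp-≐ D (lift (restrict A (head∈,₁ i₁))) (≐-sym (∩-narrow A⊆D within))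
    ... | inj₂ mΓ  = restrict C (∈,₁⁺ i₁ mΓ)

  BrS-replace⁻ : ∀ {Δ₁ Δ Γ A D X} → Δ₁ is Γ ,₁ A → Δ is Γ ,₁ D → names A ⊆ˢ names D
               → BrS Δ X → Br A (X ∩ˢ names D) → BrS Δ₁ X
  BrS-replace⁻ {Δ₁} {Δ} {Γ} {A} {D} {X} i₁ i A⊆D (sub , restrict) bA = sub′ , restrict′
    where
    within : (X ∩ˢ names D) ⊆ˢ names A
    within = Br⇒⊆names A bA
    sub′ : X ⊆ˢ namesL Δ₁
    sub′ z p with namesL-,₁⁻ i (sub z p)
    ... | inj₁ d = namesL-,₁⁺ i₁ (inj₁ (within z (∈-∩⁺ {X} {names D} p d)))
    ... | inj₂ g = namesL-,₁⁺ i₁ (inj₂ g)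
    restrict′ : ∀ C → C ∈ Δ₁ → Br C (X ∩ˢ names C)
    restrict′ C m with ∈,₁⁻ i₁ m
    ... | inj₁ refl = Br-resp-≐ A bA (∩-narrow A⊆D within)
    ... | inj₂ mΓ  = restrict C (∈,₁⁺ i mΓ)

  BrPair : Fm → Fm → Subset → Set
  BrPair C D X = ∃₂ λ P Q → Br C P × Br D Q × X ≐ (P ∪ˢ Q)

  BrPair-swap : ∀ {C D X} → BrPair C D X → BrPair D C X
  BrPair-swap (P , Q , bP , bQ , e) = Q , P , bQ , bP , ≐-trans e (∪-comm P Q)

  LinkWithin : List (ℕ × ℕ) → Subset → Set
  LinkWithin L X = ∃₂ λ x y → (x , y) ∈ L × x ∈ˢ X × y ∈ˢ X

  LinkWithin-mono : ∀ {L L′ X X′} → (∀ {e} → e ∈ L → e ∈ L′) → X ⊆ˢ X′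
                  → LinkWithin L X → LinkWithin L′ X′
  LinkWithin-mono f g (x , y , m , px , py) = x , y , f m , g x px , g y py

module Literals (𝒜 : AtomSys) where
  open AtomSys 𝒜
  open GS4 𝒜
  open Sequents 𝒜

  atomAt : Fm → ℕ → Maybe Atom
  atomAt₂ : Fm → Fm → ℕ → Maybe Atom

  atomAt (atom α x) z = if z ≡ᵇ x then just α else nothing
  atomAt (A ⋁ B)    z = atomAt₂ A B z
  atomAt (A ⋀ B)    z = atomAt₂ A B z

  atomAt₂ A B z = if names A z then atomAt A z else atomAt B z

  atomAt⇒names : ∀ C {z a} → atomAt C z ≡ just a → z ∈ˢ names C
  atomAt₂⇒names : ∀ A B {z a} → atomAt₂ A B z ≡ just a → z ∈ˢ (names A ∪ˢ names B)

  atomAt⇒names (atom α x) {z} p with z ≡ᵇ x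
  ... | true = refl
  atomAt⇒names (A ⋁ B) = atomAt₂⇒names A B
  atomAt⇒names (A ⋀ B) = atomAt₂⇒names A B

  atomAt₂⇒names A B {z} p with names A z
  ... | true  = refl
  ... | false = atomAt⇒names B p

  atomAt₂-left : ∀ A B {z a} → atomAt A z ≡ just a → atomAt₂ A B z ≡ just a
  atomAt₂-left A B p rewrite atomAt⇒names A p = p

  atomAt₂-right : ∀ A B {z a} → DisjointS (names A) (names B) → atomAt B z ≡ just a → atomAt₂ A B z ≡ just a
  atomAt₂-right A B {z} A#B p rewrite ¬∈ˢ⇒∉ˢ {names A} {z} (λ q → A#B z q (atomAt⇒names B p)) = p

  atomAt-neg : ∀ C {z a} → atomAt (neg C) z ≡ just a → atomAt C z ≡ just (bar a)
  atomAt-neg (atom α x) {z} p with z ≡ᵇ x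
  atomAt-neg (atom α x) refl | true = cong just (sym (bar-inv α))
  atomAt-neg (A ⋁ B) {z} p rewrite names-neg A z with names A z
  ... | true  = atomAt-neg A p
  ... | false = atomAt-neg B p
  atomAt-neg (A ⋀ B) {z} p rewrite names-neg A z with names A z
  ... | true  = atomAt-neg A p
  ... | false = atomAt-neg B p

  atomAtS : Seq → ℕ → Maybe Atom
  atomAtS []      z = nothing
  atomAtS (C ∷ Γ) z = if names C z then atomAt C z else atomAtS Γ z

  atomAtS-∈ : ∀ Γ {C z a} → Separated Γ → C ∈ Γ → atomAt C z ≡ just a → ¬¬ (atomAtS Γ z ≡ just a)
  atomAtS-∈ (C ∷ Γ) sep (here refl) p k rewrite atomAt⇒names C p = k p
  atomAtS-∈ (C′ ∷ Γ) {C} {z} sep (there m) p k with names C′ z in e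
  ... | true  = ¬¬-excluded-middle {A = C′ ≡ C} λ
    { (yes refl) → k p
    ; (no C′≢C)  → sep C′ C (here refl) (there m) C′≢C z e (atomAt⇒names C p) }
  ... | false = atomAtS-∈ Γ (separated-mono there sep) m p k

  Occurs : Seq → ℕ → Atom → Set
  Occurs Δ z a = ∃ λ C → C ∈ Δ × atomAt C z ≡ just a

  ComplementaryIn : Seq → ℕ → ℕ → Set
  ComplementaryIn Δ x y = ∃ λ a → Occurs Δ x a × Occurs Δ y (bar a)

  Embeds : Seq → Seq → Set
  Embeds Δ Δ′ = ∀ {C} → C ∈ Δ → ∀ {z a} → atomAt C z ≡ just a → Occurs Δ′ z a

  embeds-⊆ : ∀ {Δ Δ′} → (∀ {C} → C ∈ Δ → C ∈ Δ′) → Embeds Δ Δ′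
  embeds-⊆ f m p = -, f m , p

  ComplementaryIn-map : ∀ {Δ Δ′ x y} → Embeds Δ Δ′ → ComplementaryIn Δ x y → ComplementaryIn Δ′ x y
  ComplementaryIn-map f (a , (_ , m , p) , (_ , m′ , p′)) = a , f m p , f m′ p′

module IdentityGraphs (𝒜 : AtomSys) where
  open AtomSys 𝒜
  open GS4 𝒜
  open Branches 𝒜
  open Literals 𝒜

  Dual : Fm → Fm → Set
  Dual (atom α x) (atom β y) = β ≡ bar α
  Dual (C₁ ⋁ C₂)  (D₁ ⋀ D₂)  = Dual C₁ D₁ × Dual C₂ D₂
  Dual (C₁ ⋀ C₂)  (D₁ ⋁ D₂)  = Dual C₁ D₁ × Dual C₂ D₂
  Dual _          _          = ⊥

  private
    u⋁-injective : ∀ {a b c d} → a u⋁ b ≡ c u⋁ d → a ≡ c × b ≡ d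
    u⋁-injective refl = refl , refl

    u⋀-injective : ∀ {a b c d} → a u⋀ b ≡ c u⋀ d → a ≡ c × b ≡ d
    u⋀-injective refl = refl , refl

  ≡ₑ⇒Dual : ∀ A B → A ≡ₑ B → Dual A (neg B)
  ≡ₑ⇒Dual (atom α x) (atom .α y) refl = refl
  ≡ₑ⇒Dual (A₁ ⋁ A₂) (B₁ ⋁ B₂) e =
    ≡ₑ⇒Dual A₁ B₁ (proj₁ (u⋁-injective e)) , ≡ₑ⇒Dual A₂ B₂ (proj₂ (u⋁-injective e))
  ≡ₑ⇒Dual (A₁ ⋀ A₂) (B₁ ⋀ B₂) e =
    ≡ₑ⇒Dual A₁ B₁ (proj₁ (u⋀-injective e)) , ≡ₑ⇒Dual A₂ B₂ (proj₂ (u⋀-injective e))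
  ≡ₑ⇒Dual (atom _ _) (_ ⋁ _)    ()
  ≡ₑ⇒Dual (atom _ _) (_ ⋀ _)    ()
  ≡ₑ⇒Dual (_ ⋁ _)    (atom _ _) ()
  ≡ₑ⇒Dual (_ ⋁ _)    (_ ⋀ _)    ()
  ≡ₑ⇒Dual (_ ⋀ _)    (atom _ _) ()
  ≡ₑ⇒Dual (_ ⋀ _)    (_ ⋁ _)    ()

  Dual-sym : ∀ C D → Dual C D → Dual D C
  Dual-sym (atom α x) (atom β y) p       = bar-swap p
    where open Atoms 𝒜
  Dual-sym (C₁ ⋁ C₂)  (D₁ ⋀ D₂)  (p , q) = Dual-sym C₁ D₁ p , Dual-sym C₂ D₂ q
  Dual-sym (C₁ ⋀ C₂)  (D₁ ⋁ D₂)  (p , q) = Dual-sym C₁ D₁ p , Dual-sym C₂ D₂ q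

  idLinks : Fm → Fm → List (ℕ × ℕ)
  idLinks (atom α x) (atom β y) = [ (x , y) ]
  idLinks (C₁ ⋁ C₂)  (D₁ ⋀ D₂)  = idLinks C₁ D₁ ++ idLinks C₂ D₂
  idLinks (C₁ ⋀ C₂)  (D₁ ⋁ D₂)  = idLinks D₁ C₁ ++ idLinks D₂ C₂
  idLinks _          _          = []

  embeds-pair : ∀ {C D C′ D′ Δ} → C′ ∈ Δ → D′ ∈ Δ
              → (∀ {z a} → atomAt C z ≡ just a → atomAt C′ z ≡ just a)
              → (∀ {z a} → atomAt D z ≡ just a → atomAt D′ z ≡ just a)
              → Embeds (C ∷ D ∷ []) Δ
  embeds-pair mC mD f g (here refl)         p = -, mC , f p
  embeds-pair mC mD f g (there (here refl)) p = -, mD , g p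

  idLink-complementary : ∀ C D {x y} → SharingFreeFm C → SharingFreeFm D → Dual C D
                       → (x , y) ∈ idLinks C D → ComplementaryIn (C ∷ D ∷ []) x y
  idLink-complementary (atom α x) (atom β y) _ _ refl (here refl) =
    α , (-, here refl , at x) , (-, there (here refl) , at y)
    where
    at : ∀ {γ} x → atomAt (atom γ x) x ≡ just γ
    at x rewrite ∈⟦⟧₁ x = refl
  idLink-complementary (C₁ ⋁ C₂) (D₁ ⋀ D₂) (sC₁ , sC₂ , C₁#C₂) (sD₁ , sD₂ , D₁#D₂) (d₁ , d₂) m
    with ∈-++⁻ (idLinks C₁ D₁) m
  ... | inj₁ m₁ = ComplementaryIn-map
                    (embeds-pair (here refl) (there (here refl)) (atomAt₂-left C₁ C₂) (atomAt₂-left D₁ D₂))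
                    (idLink-complementary C₁ D₁ sC₁ sD₁ d₁ m₁)
  ... | inj₂ m₂ = ComplementaryIn-map
                    (embeds-pair (here refl) (there (here refl))
                                 (atomAt₂-right C₁ C₂ C₁#C₂) (atomAt₂-right D₁ D₂ D₁#D₂))
                    (idLink-complementary C₂ D₂ sC₂ sD₂ d₂ m₂)
  idLink-complementary (C₁ ⋀ C₂) (D₁ ⋁ D₂) (sC₁ , sC₂ , C₁#C₂) (sD₁ , sD₂ , D₁#D₂) (d₁ , d₂) m
    with ∈-++⁻ (idLinks D₁ C₁) m
  ... | inj₁ m₁ = ComplementaryIn-map
                    (embeds-pair (there (here refl)) (here refl) (atomAt₂-left D₁ D₂) (atomAt₂-left C₁ C₂))
                    (idLink-complementary D₁ C₁ sD₁ sC₁ (Dual-sym C₁ D₁ d₁) m₁)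
  ... | inj₂ m₂ = ComplementaryIn-map
                    (embeds-pair (there (here refl)) (here refl)
                                 (atomAt₂-right D₁ D₂ D₁#D₂) (atomAt₂-right C₁ C₂ C₁#C₂))
                    (idLink-complementary D₂ C₂ sD₂ sC₂ (Dual-sym C₂ D₂ d₂) m₂)

  wk-edge : ∀ C G {x y X} → Rel G x y X → Rel (wk [ C ] G) x y (X ∪ˢ leftBranch C)
  wk-edge C G rel = -, -, rel , BrS-[ C ] (Br-leftBranch C) , λ z → refl

  BrPair-⋁⋀ˡ : ∀ {C₁ C₂ D₁ D₂ X Y} → BrPair C₁ D₁ X → Br C₂ Y
             → BrPair (C₁ ⋁ C₂) (D₁ ⋀ D₂) (X ∪ˢ Y)
  BrPair-⋁⋀ˡ {X = X} {Y} (P , Q , bP , bQ , e) bY =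
    P ∪ˢ Y , Q , (P , Y , bP , bY , λ z → refl) , inj₁ bQ , ∪-rearrange {X} {P} {Q} Y e

  BrPair-⋁⋀ʳ : ∀ {C₁ C₂ D₁ D₂ X Y} → BrPair C₂ D₂ X → Br C₁ Y
             → BrPair (C₁ ⋁ C₂) (D₁ ⋀ D₂) (X ∪ˢ Y)
  BrPair-⋁⋀ʳ {X = X} {Y} (P , Q , bP , bQ , e) bY =
    P ∪ˢ Y , Q , (Y , P , bY , bP , ∪-comm P Y) , inj₂ bQ , ∪-rearrange {X} {P} {Q} Y e

  idLink-edge : ∀ C D {x y} → (x , y) ∈ idLinks C D → ∃ λ X → Rel (idG C D) x y X × BrPair C D X
  idLink-edge (atom α x) (atom β y) (here refl) =
    -, (refl , refl , λ z → refl) , ⟦ x ⟧₁ , ⟦ y ⟧₁ , (λ z → refl) , (λ z → refl) , λ z → refl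
  idLink-edge (C₁ ⋁ C₂) (D₁ ⋀ D₂) m with ∈-++⁻ (idLinks C₁ D₁) m
  ... | inj₁ m₁ with _ , rel , pair ← idLink-edge C₁ D₁ m₁ =
    -, inj₁ (wk-edge C₂ (idG C₁ D₁) rel) , BrPair-⋁⋀ˡ pair (Br-leftBranch C₂)
  ... | inj₂ m₂ with _ , rel , pair ← idLink-edge C₂ D₂ m₂ =
    -, inj₂ (wk-edge C₁ (idG C₂ D₂) rel) , BrPair-⋁⋀ʳ pair (Br-leftBranch C₁)
  idLink-edge (C₁ ⋀ C₂) (D₁ ⋁ D₂) m with ∈-++⁻ (idLinks D₁ C₁) m
  ... | inj₁ m₁ with _ , rel , pair ← idLink-edge D₁ C₁ m₁ =
    -, inj₁ (wk-edge D₂ (idG D₁ C₁) rel) , BrPair-swap (BrPair-⋁⋀ˡ pair (Br-leftBranch D₂))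
  ... | inj₂ m₂ with _ , rel , pair ← idLink-edge D₂ C₂ m₂ =
    -, inj₂ (wk-edge D₁ (idG D₂ C₂) rel) , BrPair-swap (BrPair-⋁⋀ʳ pair (Br-leftBranch D₁))

  idLinks-meet : ∀ C D {P Q} → Dual C D → Br C P → Br D Q → LinkWithin (idLinks C D) (P ∪ˢ Q)
  idLinks-meet (atom α x) (atom β y) {P} {Q} _ bP bQ =
    x , y , here refl , ∈-∪⁺ˡ {P} {Q} (trans (bP x) (∈⟦⟧₁ x)) ,
                        ∈-∪⁺ʳ {P} {Q} (trans (bQ y) (∈⟦⟧₁ y))
  idLinks-meet (C₁ ⋁ C₂) (D₁ ⋀ D₂) {P} {Q} (d₁ , d₂) (P₁ , P₂ , b₁ , b₂ , e) (inj₁ bQ) =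
    LinkWithin-mono ∈-++⁺ˡ (∪-mono (≐∪⇒⊆ˡ e) λ _ q → q)
                    (idLinks-meet C₁ D₁ d₁ b₁ bQ)
  idLinks-meet (C₁ ⋁ C₂) (D₁ ⋀ D₂) {P} {Q} (d₁ , d₂) (P₁ , P₂ , b₁ , b₂ , e) (inj₂ bQ) =
    LinkWithin-mono (∈-++⁺ʳ _) (∪-mono (≐∪⇒⊆ʳ e) λ _ q → q)
                    (idLinks-meet C₂ D₂ d₂ b₂ bQ)
  idLinks-meet (C₁ ⋀ C₂) (D₁ ⋁ D₂) {P} {Q} (d₁ , d₂) (inj₁ bP) (Q₁ , Q₂ , b₁ , b₂ , e) =
    LinkWithin-mono ∈-++⁺ˡ (⊆-trans (∪-mono (≐∪⇒⊆ˡ e) λ _ q → q) (≐⇒⊆ (∪-comm Q P)))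
                    (idLinks-meet D₁ C₁ (Dual-sym C₁ D₁ d₁) b₁ bP)
  idLinks-meet (C₁ ⋀ C₂) (D₁ ⋁ D₂) {P} {Q} (d₁ , d₂) (inj₂ bP) (Q₁ , Q₂ , b₁ , b₂ , e) =
    LinkWithin-mono (∈-++⁺ʳ _) (⊆-trans (∪-mono (≐∪⇒⊆ʳ e) λ _ q → q) (≐⇒⊆ (∪-comm Q P)))
                    (idLinks-meet D₂ C₂ (Dual-sym C₂ D₂ d₂) b₂ bP)

  idG-vertices : ∀ C D → Dual C D → ∀ {z} → z ∈ˢ names C ⊎ z ∈ˢ names D → V (idG C D) z
  idG-vertices (atom α x) (atom β y) _ {z} (inj₁ p) = ∈-∪⁺ˡ {⟦ x ⟧₁} {⟦ y ⟧₁} {z} p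
  idG-vertices (atom α x) (atom β y) _ {z} (inj₂ p) = ∈-∪⁺ʳ {⟦ x ⟧₁} {⟦ y ⟧₁} {z} p
  idG-vertices (C₁ ⋁ C₂) (D₁ ⋀ D₂) (d₁ , d₂) p
    with Sum.map (∈-∪⁻ {names C₁} {names C₂}) (∈-∪⁻ {names D₁} {names D₂}) p
  ... | inj₁ (inj₁ q) = inj₁ (inj₁ (idG-vertices C₁ D₁ d₁ (inj₁ q)))
  ... | inj₁ (inj₂ q) = inj₂ (inj₁ (idG-vertices C₂ D₂ d₂ (inj₁ q)))
  ... | inj₂ (inj₁ q) = inj₁ (inj₁ (idG-vertices C₁ D₁ d₁ (inj₂ q)))
  ... | inj₂ (inj₂ q) = inj₂ (inj₁ (idG-vertices C₂ D₂ d₂ (inj₂ q)))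
  idG-vertices (C₁ ⋀ C₂) (D₁ ⋁ D₂) (d₁ , d₂) p
    with Sum.map (∈-∪⁻ {names C₁} {names C₂}) (∈-∪⁻ {names D₁} {names D₂}) p
  ... | inj₁ (inj₁ q) = inj₁ (inj₁ (idG-vertices D₁ C₁ (Dual-sym C₁ D₁ d₁) (inj₂ q)))
  ... | inj₁ (inj₂ q) = inj₂ (inj₁ (idG-vertices D₂ C₂ (Dual-sym C₂ D₂ d₂) (inj₂ q)))
  ... | inj₂ (inj₁ q) = inj₁ (inj₁ (idG-vertices D₁ C₁ (Dual-sym C₁ D₁ d₁) (inj₁ q)))
  ... | inj₂ (inj₂ q) = inj₂ (inj₁ (idG-vertices D₂ C₂ (Dual-sym C₂ D₂ d₂) (inj₁ q)))

module Links (𝒜 : AtomSys) where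
  open GS4 𝒜
  open Sequents 𝒜
  open Branches 𝒜
  open Literals 𝒜
  open IdentityGraphs 𝒜

  links : ∀ {Δ} → Deriv Δ → List (ℕ × ℕ)
  links (ax _ A B _ _ _)        = idLinks A (neg B)
  links (cut _ _ _ _ _ _)       = []
  links (sup _ _ _ P Q)         = links P ++ links Q
  links (or _ _ _ _ _ _ P)      = links P
  links (and _ _ _ _ _ _ _ P Q) = links P ++ links Q

  link-edge : ∀ {Δ} (P : Deriv Δ) → CutFree P → ∀ {x y} → (x , y) ∈ links P
            → ∃ λ L → Rel ⟪ P ⟫ x y L × BrS Δ L
  link-edge (ax Γ A B _ sf i) _ m with X , rel , P , Q , bP , bQ , e ← idLink-edge A (neg B) m =
    X ∪ˢ R , (X , R , rel , bR , λ z → refl) ,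
    BrS-resp-≐ (BrS-,₂ i bP bQ bR) (≐-sym (≐-trans (λ z → cong (_∨ R z) (e z)) (∪-assoc P Q R)))
    where
    R = leftBranchS Γ
    bR = BrS-leftBranchS Γ (separated-mono (∈,₂⁺ i) (proj₂ sf))
  link-edge (sup _ eq₁ eq₂ P Q) (cP , cQ) m with ∈-++⁻ (links P) m
  ... | inj₁ mP with L , rel , b ← link-edge P cP mP = L , inj₁ rel , BrS-resp-≈ eq₁ b
  ... | inj₂ mQ with L , rel , b ← link-edge Q cQ mQ = L , inj₂ rel , BrS-resp-≈ eq₂ b
  link-edge (or _ _ _ _ i₁ i P) cP m with L , rel , b ← link-edge P cP m = L , rel , BrS-⋁⁺ i₁ i b
  link-edge (and _ A B _ iP iQ i P Q) (cP , cQ) m with ∈-++⁻ (links P) m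
  ... | inj₁ mP with L , rel , b ← link-edge P cP mP =
    L , inj₁ rel , BrS-replace⁺ iP i (⊆-∪ˡ {names A} {names B}) inj₁ b
  ... | inj₂ mQ with L , rel , b ← link-edge Q cQ mQ =
    L , inj₂ rel , BrS-replace⁺ iQ i (⊆-∪ʳ {names A} {names B}) inj₂ b

  branch-link : ∀ {Δ} (P : Deriv Δ) → CutFree P → ∀ {X} → BrS Δ X → LinkWithin (links P) X
  branch-link (ax Γ A B ≡ₑ _ i) _ {X} (_ , restrict) =
    LinkWithin-mono (λ m → m) (∪-least (∩-⊆ˡ {X} {names A}) (∩-⊆ˡ {X} {names (neg B)}))
      (idLinks-meet A (neg B) (≡ₑ⇒Dual A B ≡ₑ) (restrict A (fst∈,₂ i)) (restrict (neg B) (snd∈,₂ i)))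
  branch-link (sup _ eq₁ _ P _) (cP , _) b =
    LinkWithin-mono ∈-++⁺ˡ (λ _ p → p) (branch-link P cP (BrS-resp-≈ (≈-sym eq₁) b))
  branch-link (or _ A B sf i₁ i P) cP b =
    branch-link P cP (BrS-⋁⁻ i₁ i (proj₂ (proj₂ (sharingFree-∈ sf (head∈,₁ i)))) b)
  branch-link (and _ A B _ iP iQ i P Q) (cP , cQ) b@(_ , restrict) with restrict _ (head∈,₁ i)
  ... | inj₁ bA = LinkWithin-mono ∈-++⁺ˡ (λ _ p → p)
                    (branch-link P cP (BrS-replace⁻ iP i (⊆-∪ˡ {names A} {names B}) b bA))
  ... | inj₂ bB = LinkWithin-mono (∈-++⁺ʳ _) (λ _ p → p)
                    (branch-link Q cQ (BrS-replace⁻ iQ i (⊆-∪ʳ {names A} {names B}) b bB))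

  embeds-replace : ∀ {Δ₁ Δ Γ A D} → Δ₁ is Γ ,₁ A → Δ is Γ ,₁ D
                 → (∀ {z a} → atomAt A z ≡ just a → atomAt D z ≡ just a) → Embeds Δ₁ Δ
  embeds-replace i₁ i f m p with ∈,₁⁻ i₁ m
  ... | inj₁ refl = -, head∈,₁ i , f p
  ... | inj₂ mΓ  = -, ∈,₁⁺ i mΓ , p

  embeds-⋁ : ∀ {Δ₁ Δ Γ A B} → Δ₁ is Γ ,₂ A , B → Δ is Γ ,₁ (A ⋁ B) → DisjointS (names A) (names B)
           → Embeds Δ₁ Δ
  embeds-⋁ {A = A} {B} i₁ i A#B m p with ∈,₂⁻ i₁ m
  ... | inj₁ refl        = -, head∈,₁ i , atomAt₂-left A B p
  ... | inj₂ (inj₁ refl) = -, head∈,₁ i , atomAt₂-right A B A#B p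
  ... | inj₂ (inj₂ mΓ)  = -, ∈,₁⁺ i mΓ , p

  link-complementary : ∀ {Δ} (P : Deriv Δ) → CutFree P → ∀ {x y} → (x , y) ∈ links P → ComplementaryIn Δ x y
  link-complementary (ax _ A B ≡ₑ sf i) _ m =
    ComplementaryIn-map (embeds-⊆ λ { (here refl) → fst∈,₂ i ; (there (here refl)) → snd∈,₂ i })
      (idLink-complementary A (neg B) (sharingFree-∈ sf (fst∈,₂ i)) (sharingFree-∈ sf (snd∈,₂ i))
                            (≡ₑ⇒Dual A B ≡ₑ) m)
  link-complementary (sup _ eq₁ eq₂ P Q) (cP , cQ) m with ∈-++⁻ (links P) m
  ... | inj₁ mP = ComplementaryIn-map (embeds-⊆ (≈⇒⊆ eq₁)) (link-complementary P cP mP)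
  ... | inj₂ mQ = ComplementaryIn-map (embeds-⊆ (≈⇒⊆ eq₂)) (link-complementary Q cQ mQ)
  link-complementary (or _ A B sf i₁ i P) cP m =
    ComplementaryIn-map (embeds-⋁ i₁ i (proj₂ (proj₂ (sharingFree-∈ sf (head∈,₁ i)))))
      (link-complementary P cP m)
  link-complementary (and _ A B sf iP iQ i P Q) (cP , cQ) m with ∈-++⁻ (links P) m
  ... | inj₁ mP = ComplementaryIn-map (embeds-replace iP i (atomAt₂-left A B)) (link-complementary P cP mP)
  ... | inj₂ mQ = ComplementaryIn-map (embeds-replace iQ i (atomAt₂-right A B A#B)) (link-complementary Q cQ mQ)
    where A#B = proj₂ (proj₂ (sharingFree-∈ sf (head∈,₁ i)))

  names⊆vertices : ∀ {Δ} (P : Deriv Δ) → CutFree P → ∀ {z} → z ∈ˢ namesL Δ → V ⟪ P ⟫ z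
  names⊆vertices (ax _ A B ≡ₑ _ i) _ p with namesL-,₂⁻ i p
  ... | inj₁ a         = inj₁ (idG-vertices A (neg B) (≡ₑ⇒Dual A B ≡ₑ) (inj₁ a))
  ... | inj₂ (inj₁ b) = inj₁ (idG-vertices A (neg B) (≡ₑ⇒Dual A B ≡ₑ) (inj₂ b))
  ... | inj₂ (inj₂ g) = inj₂ g
  names⊆vertices (sup _ eq₁ _ P _) (cP , _) p =
    inj₁ (names⊆vertices P cP (namesL-mono (≈⇒⊆ (≈-sym eq₁)) _ p))
  names⊆vertices (or _ A B _ i₁ i P) cP p with namesL-,₁⁻ i p
  ... | inj₁ ab = names⊆vertices P cP (namesL-,₂⁺ i₁ (Sum.map₂ inj₁ (∈-∪⁻ {names A} {names B} ab)))
  ... | inj₂ g  = names⊆vertices P cP (namesL-,₂⁺ i₁ (inj₂ (inj₂ g)))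
  names⊆vertices (and _ A B _ iP iQ i P Q) (cP , cQ) p with namesL-,₁⁻ i p
  ... | inj₂ g  = inj₁ (names⊆vertices P cP (namesL-,₁⁺ iP (inj₂ g)))
  ... | inj₁ ab with ∈-∪⁻ {names A} {names B} ab
  ...   | inj₁ a = inj₁ (names⊆vertices P cP (namesL-,₁⁺ iP (inj₁ a)))
  ...   | inj₂ b = inj₂ (names⊆vertices Q cQ (namesL-,₁⁺ iQ (inj₁ b)))

module Cuts (𝒜 : AtomSys) where
  open AtomSys 𝒜
  open GS4 𝒜
  open Sequents 𝒜
  open Branches 𝒜
  open Literals 𝒜
  open Links 𝒜

  BranchAvoiding : (ℕ → Set) → Fm → Set
  BranchAvoiding S A = ∃ λ Y → Br A Y × (∀ z → z ∈ˢ Y → ¬ S z)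

  BranchWithin : (ℕ → Set) → Fm → Set
  BranchWithin S A = ∃ λ Z → Br A Z × (∀ z → z ∈ˢ Z → S z)

  branch-dichotomy : ∀ S A → ¬¬ (BranchAvoiding S A ⊎ BranchWithin S (neg A))
  branch-dichotomy S (atom α x) k = ¬¬-excluded-middle {A = S x} λ
    { (yes s) → k (inj₂ (⟦ x ⟧₁ , (λ z → refl) , λ z p → subst S (sym (∈⟦⟧₁⁻ p)) s))
    ; (no ¬s) → k (inj₁ (⟦ x ⟧₁ , (λ z → refl) , λ z p → ¬s ∘ subst S (∈⟦⟧₁⁻ p))) }
  branch-dichotomy S (B ⋁ C) k = branch-dichotomy S B λ
    { (inj₂ (Z , bZ , s)) → k (inj₂ (Z , inj₁ bZ , s))
    ; (inj₁ (Y₁ , b₁ , n₁)) → branch-dichotomy S C λ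
      { (inj₂ (Z , bZ , s))  → k (inj₂ (Z , inj₂ bZ , s))
      ; (inj₁ (Y₂ , b₂ , n₂)) → k (inj₁ (Y₁ ∪ˢ Y₂ , (Y₁ , Y₂ , b₁ , b₂ , λ z → refl) ,
                                       λ z p → Sum.[ n₁ z , n₂ z ] (∈-∪⁻ {Y₁} {Y₂} p))) } }
  branch-dichotomy S (B ⋀ C) k = branch-dichotomy S B λ
    { (inj₁ (Y , bY , n)) → k (inj₁ (Y , inj₁ bY , n))
    ; (inj₂ (Z₁ , b₁ , s₁)) → branch-dichotomy S C λ
      { (inj₁ (Y , bY , n))  → k (inj₁ (Y , inj₂ bY , n))
      ; (inj₂ (Z₂ , b₂ , s₂)) → k (inj₂ (Z₁ ∪ˢ Z₂ , (Z₁ , Z₂ , b₁ , b₂ , λ z → refl) ,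
                                       λ z p → Sum.[ s₁ z , s₂ z ] (∈-∪⁻ {Z₁} {Z₂} p))) } }

  -- Γ being atomic, every branch of ⊢ Γ, F contains all of names Γ.
  branch-off-cut : ∀ {Δ Γ F L J} → Δ is Γ ,₁ F → All IsAtomic Γ → names F ≐ J → BrS Δ L
                 → namesL Γ ≐ (L ∖ˢ J)
  branch-off-cut {Δ} {Γ} {F} {L} {J} i@(_ , Γ#F) at F≐J (sub , restrict) = ⊆-antisym to from
    where
    to : namesL Γ ⊆ˢ (L ∖ˢ J)
    to z p with C , m , q ← ∈namesL⁻ {Γ} p with α , n , refl ← All.lookup at m =
      ∈-∖⁺ {L} {J} (∩-⊆ˡ {L} {⟦ n ⟧₁} z (trans (restrict _ (∈,₁⁺ i m) z) q))
                   (¬∈ˢ⇒∉ˢ {J} λ j → Γ#F z p (trans (F≐J z) j))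
    from : (L ∖ˢ J) ⊆ˢ namesL Γ
    from z p with l , ¬j ← ∈-∖⁻ {L} {J} p with namesL-,₁⁻ i (sub z l)
    ... | inj₁ f = ⊥-elim (∈ˢ⇒¬∉ˢ {J} (trans (sym (F≐J z)) f) ¬j)
    ... | inj₂ g = g

  module AtomicContext (Γ : Seq) (A : Fm) {Δ₁ Δ₂ : Seq} (P : Deriv Δ₁) (Q : Deriv Δ₂)
                 (cP : CutFree P) (cQ : CutFree Q) (i₁ : Δ₁ is Γ ,₁ A) (i₂ : Δ₂ is Γ ,₁ neg A)
                 (at : All IsAtomic Γ) where

    anyAtom : Fm → Atom
    anyAtom (atom α _) = α
    anyAtom (B ⋁ _)    = anyAtom B
    anyAtom (B ⋀ _)    = anyAtom B

    -- The default atom is junk: only names occurring in Δ₁ matter.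
    lit : ℕ → Atom
    lit z = fromMaybe (anyAtom A) (atomAtS Δ₁ z)

    open AlternatingPaths 𝒜 (names A) (links P) (links Q) lit public

    conclusion : Bool → Seq
    conclusion true  = Δ₁
    conclusion false = Δ₂

    graph : Bool → BLGraph
    graph true  = ⟪ P ⟫
    graph false = ⟪ Q ⟫

    side-link-complementary : ∀ c {u v} → (u , v) ∈ linksOf c → ComplementaryIn (conclusion c) u v
    side-link-complementary true  = link-complementary P cP
    side-link-complementary false = link-complementary Q cQ

    side-link-edge : ∀ c {u v} → (u , v) ∈ linksOf c → ∃ λ L → Rel (graph c) u v L × BrS (conclusion c) L
    side-link-edge true  = link-edge P cP
    side-link-edge false = link-edge Q cQ

    occurs-lit₁ : ∀ {u a} → Occurs Δ₁ u a → ¬¬ (lit u ≡ a)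
    occurs-lit₁ (C , m , p) k =
      atomAtS-∈ Δ₁ (proj₂ (conclusion-sharingFree P)) m p (k ∘ cong (fromMaybe (anyAtom A)))

    occurs-lit : ∀ c {u a} → Occurs (conclusion c) u a → ¬¬ (litOn c u ≡ a)
    occurs-lit true = occurs-lit₁
    occurs-lit false {u} {a} (C , m , p) k with ∈,₁⁻ i₂ m
    ... | inj₁ refl = occurs-lit₁ (A , head∈,₁ i₁ , atomAt-neg A p) λ e →
      k (trans (litOn-cut true u∈A) (trans (cong bar e) (bar-inv a)))
      where
      u∈A : u ∈ˢ names A
      u∈A = trans (sym (names-neg A u)) (atomAt⇒names (neg A) p)
    ... | inj₂ mΓ = occurs-lit₁ (C , ∈,₁⁺ i₁ mΓ , p) (k ∘ trans (litOn-free false u∉A))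
      where
      u∉A : u ∉ˢ names A
      u∉A = ¬∈ˢ⇒∉ˢ {names A} λ a →
        proj₂ i₂ u (∈namesL⁺ mΓ (atomAt⇒names C p)) (trans (names-neg A u) a)

    complementary : ∀ c {u v} → Link c u v → ¬¬ (litOn c u ≡ bar (litOn c v))
    complementary c (inj₁ m) k with a , ou , ov ← side-link-complementary c m =
      occurs-lit c ou λ eu → occurs-lit c ov λ ev → k (trans eu (sym (trans (cong bar ev) (bar-inv a))))
    complementary c (inj₂ m) k with a , ov , ou ← side-link-complementary c m =
      occurs-lit c ou λ eu → occurs-lit c ov λ ev → k (trans eu (cong bar (sym ev)))

    cut-part : ∀ {Δ F} → Δ is Γ ,₁ F → names F ≐ names A → ∀ Y {z}
             → z ∈ˢ (Y ∪ˢ namesL Γ) → z ∈ˢ names A → z ∈ˢ Y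
    cut-part (_ , Γ#F) F≐A Y {z} p a with ∈-∪⁻ {Y} {namesL Γ} p
    ... | inj₁ y = y
    ... | inj₂ g = ⊥-elim (Γ#F z g (trans (F≐A z) a))

    -- A branch of A avoiding S yields a link of P avoiding S on the cut, and dually for Q.
    branching : ∀ S → ¬¬ (GLinkAvoiding S ⊎ HLinkWithin S)
    branching S k = branch-dichotomy S A λ
      { (inj₁ (Y , bY , avoid)) →
          let x , y , m , px , py = branch-link P cP (BrS-,₁ i₁ bY (BrS-atomic at))
          in k (inj₁ (x , y , m , avoid x ∘ cut-part i₁ (λ _ → refl) Y px ,
                                  avoid y ∘ cut-part i₁ (λ _ → refl) Y py))
      ; (inj₂ (Z , bZ , within)) →
          let x , y , m , px , py = branch-link Q cQ (BrS-,₁ i₂ bZ (BrS-atomic at))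
          in k (inj₂ (x , y , m , within x ∘ cut-part i₂ (names-neg A) Z px ,
                                  within y ∘ cut-part i₂ (names-neg A) Z py)) }

    label-off-cut : ∀ c {L} → BrS (conclusion c) L → namesL Γ ≐ (L ∖ˢ names A)
    label-off-cut true  = branch-off-cut i₁ at (λ _ → refl)
    label-off-cut false = branch-off-cut i₂ at (names-neg A)

    link-label : ∀ c {u v} → Link c u v → Lab (graph c) (names A) u v (namesL Γ)
    link-label c e@(inj₁ m) with L , rel , b ← side-link-edge c m =
      L , ((λ { refl → link-irreflexive complementary c e }) , inj₁ rel) , label-off-cut c b
    link-label c e@(inj₂ m) with L , rel , b ← side-link-edge c m =
      L , ((λ { refl → link-irreflexive complementary c e }) , inj₂ rel) , label-off-cut c b

    Vertex : ℕ → Set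
    Vertex z = V ⟪ P ⟫ z ⊎ V ⟪ Q ⟫ z

    occurs-vertex : ∀ c {u a} → Occurs (conclusion c) u a → Vertex u
    occurs-vertex true  (C , m , p) = inj₁ (names⊆vertices P cP (∈namesL⁺ m (atomAt⇒names C p)))
    occurs-vertex false (C , m , p) = inj₂ (names⊆vertices Q cQ (∈namesL⁺ m (atomAt⇒names C p)))

    side-link-vertex : ∀ c {u v} → Link c u v → Vertex u
    side-link-vertex c (inj₁ m) = occurs-vertex c (proj₁ (proj₂ (side-link-complementary c m)))
    side-link-vertex c (inj₂ m) = occurs-vertex c (proj₂ (proj₂ (side-link-complementary c m)))

    alternating⇒Alt : ∀ c ps → Alternating c ps → Alt (graph c) (graph (not c)) (names A) (namesL Γ) ps
    alternating⇒Alt c     []           _       = tt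
    alternating⇒Alt c     (_ ∷ [])     _       = tt
    alternating⇒Alt true  (u ∷ v ∷ ps) (e , a) = link-label true e , alternating⇒Alt false (v ∷ ps) a
    alternating⇒Alt false (u ∷ v ∷ ps) (e , a) = link-label false e , alternating⇒Alt true (v ∷ ps) a

    label-vertex : ∀ z → z ∈ˢ namesL Γ → Vertex z × z ∉ˢ names A
    label-vertex z p = inj₁ (names⊆vertices P cP (namesL-,₁⁺ i₁ (inj₂ p))) ,
                       ¬∈ˢ⇒∉ˢ {names A} (proj₂ i₁ z p)

    completeAltPath⇒edge : CompleteAltPath → HasEdge (⟪ P ⟫ ⊙[ names A ] ⟪ Q ⟫)
    completeAltPath⇒edge (c , x , ms , y , distinct , ms-cut , x-free , y-free , alt) =
      x , y , namesL Γ , x≢y ,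
      inj₁ (x≢y , (All.head vs , x-free) , (y-vertex , y-free) , label-vertex ,
            ms , distinct , vs , ms-cut , x-free , y-free , onSide c alt)
      where
      vs = path-all side-link-vertex c x ms y alt
      y∈ : y ∈ ms ++ [ y ]
      y∈ = ∈-++⁺ʳ ms (here refl)
      y-vertex = All.lookup vs (there y∈)
      x≢y = All.lookup (AllPairs.head distinct) y∈
      onSide : ∀ c → Alternating c (path x ms y)
             → Alt ⟪ P ⟫ ⟪ Q ⟫ (names A) (namesL Γ) (path x ms y)
             ⊎ Alt ⟪ Q ⟫ ⟪ P ⟫ (names A) (namesL Γ) (path x ms y)
      onSide true  a = inj₁ (alternating⇒Alt true _ a)
      onSide false a = inj₂ (alternating⇒Alt false _ a)

lemma14 : (𝒜 : AtomSys) → let open GS4 𝒜 in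
    ∀ (Γ : Seq) (A : Fm) {Δ₁ Δ₂ : Seq} (P : Deriv Δ₁) (Q : Deriv Δ₂) →
    CutFree P → CutFree Q →
    Δ₁ is Γ ,₁ A → Δ₂ is Γ ,₁ neg A →
    All IsAtomic Γ →
    HasEdge (⟪ P ⟫ ⊙[ names A ] ⟪ Q ⟫)
lemma14 𝒜 Γ A P Q cP cQ i₁ i₂ at = completeAltPath⇒edge (completeAltPath complementary branching)
  where open Cuts.AtomicContext 𝒜 Γ A P Q cP cQ i₁ i₂ at
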